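{- Let $F$ be a finite field and $q=|F|$. Let $k,m,n\in\mathbb{N}$ satisfy $k\leq m\leq n+1$. Fix any $k$-tuple $a\in F^k$. Then the number of $(m+n+1)$-tuples $x\in F^{m+n+1}$ satisfying $x_{[0,k)}=a$ and $\operatorname{rank}(H_{m,n}(x))\leq m$ is $q^{2m-k}$.
   Context: $\mathbb{N}=\{0,1,2,\ldots\}$. For $x=(x_0,\ldots,x_{m+n})\in F^{m+n+1}$, $H_{m,n}(x)$ is the $(m+1)\times(n+1)$ matrix $(x_{i+j})_{0\leq i\leq m,\ 0\leq j\leq n}$. For a tuple $x$, $x_{[0,k)}=(x_0,\ldots,x_{k-1})$. -}

module Defs where

open import Level using (Level; suc; _⊔_)
import Data.Nat as ℕ
open ℕ using (ℕ; _≤_; _<_; s≤s)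
open import Data.Nat.Properties using (+-mono-≤; +-suc)
import Data.Fin
open Data.Fin using (Fin; toℕ; fromℕ<)
open import Data.Fin.Properties using (toℕ<n)
open import Data.Vec using (Vec; lookup)
open import Data.List using (List; length)
open import Data.List.Membership.Propositional using (_∈_)
open import Data.List.Relation.Unary.Unique.Propositional using (Unique)
open import Data.Product using (Σ; ∃; _×_; _,_)
open import Function.Bundles using (_↔_; _⇔_)
open import Function.Definitions using (Injective)
open import Relation.Binary.PropositionalEquality using (_≡_; _≢_; subst; sym)
open import Relation.Nullary using (¬_)
open import Algebra.Structures using (IsCommutativeRing)

record Field (c : Level) : Set (suc c) where
  infixl 7 _*_
  infixl 6 _+_
  field
    Carrier : Set c
    _+_ _*_ : Carrier → Carrier → Carrier
    -_      : Carrier → Carrier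
    0# 1#   : Carrier
    isCommutativeRing : IsCommutativeRing _≡_ _+_ _*_ -_ 0# 1#
    0≢1     : 0# ≢ 1#
    inverse : ∀ x → x ≢ 0# → ∃ λ y → x * y ≡ 1#

record FiniteField (c : Level) (q : ℕ) : Set (suc c) where
  field
    field′ : Field c
  open Field field′ public
  field
    enumeration : Carrier ↔ Fin q

module _ {c : Level} (F : Field c) where
  open Field F

  ∑ : ∀ {r} → (Fin r → Carrier) → Carrier
  ∑ {ℕ.zero}  f = 0#
  ∑ {ℕ.suc r} f = f Fin.zero + ∑ (λ t → f (Fin.suc t))

  LinearlyDependent : ∀ {d r} → (Fin r → (Fin d → Carrier)) → Set c
  LinearlyDependent {d} {r} v =
    Σ (Fin r → Carrier) λ λs →
      (∃ λ t → λs t ≢ 0#) × (∀ (i : Fin d) → ∑ (λ t → λs t * v t i) ≡ 0#)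

  column : ∀ {p s} → (Fin p → Fin s → Carrier) → Fin s → (Fin p → Carrier)
  column A j i = A i j

  -- rank(A) ≤ ρ : A has no ρ+1 linearly independent columns, i.e. every
  -- family of ρ+1 distinct columns is linearly dependent
  -- (rank = maximal number of linearly independent columns).
  RankAtMost : ∀ {p s} → ℕ → (Fin p → Fin s → Carrier) → Set c
  RankAtMost {p} {s} ρ A =
    ∀ (cols : Fin (ℕ.suc ρ) → Fin s) → Injective _≡_ _≡_ cols →
      LinearlyDependent (λ t → column A (cols t))

  private
    hankel-bound : ∀ {m n} (i : Fin (ℕ.suc m)) (j : Fin (ℕ.suc n)) →
                   toℕ i ℕ.+ toℕ j < ℕ.suc (m ℕ.+ n)
    hankel-bound {m} {n} i j with toℕ<n i | toℕ<n j
    ... | s≤s p | s≤s q = s≤s (+-mono-≤ p q)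

  -- H_{m,n}(x) = (x_{i+j})_{0≤i≤m, 0≤j≤n}, for x ∈ F^{m+n+1}.
  Hankel : ∀ m n → Vec Carrier (ℕ.suc (m ℕ.+ n)) →
           Fin (ℕ.suc m) → Fin (ℕ.suc n) → Carrier
  Hankel m n x i j = lookup x (fromℕ< (hankel-bound {m} {n} i j))

  PrefixIs : ∀ {N k} → k ≤ N → Vec Carrier N → Vec Carrier k → Set c
  PrefixIs {N} {k} k≤N x a =
    ∀ (i : Fin k) → lookup x (Data.Fin.inject≤ i k≤N) ≡ lookup a i

HasCardinality : ∀ {a p} {A : Set a} → (A → Set p) → ℕ → Set (a ⊔ p)
HasCardinality {A = A} P N =
  Σ (List A) λ xs → Unique xs × (∀ x → (x ∈ xs) ⇔ P x) × length xs ≡ N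

{-# OPTIONS --safe #-}

-- Read x as the power series Σ xᵢ zⁱ. The rows of H_{m,n}(x) are dependent exactly when some nonzero
-- polynomial C of degree ≤ m kills the coefficients m, …, m + n of C·x. If the prefix is zʲ·h with
-- h(0) ≠ 0, dividing by zʲ and passing to the reciprocal series 1/h turns this condition for (m, n)
-- into the same condition for (m - j - 1, n - j - 1) on the coefficients of 1/h from index j + 2 on.
-- Coefficientwise, h ↦ 1/h is a bijection between the extensions of a fixed prefix, so by induction
-- on m a full prefix of length m has q^m extensions; a prefix of m zeros forces the next n + 1 - m
-- entries to vanish. Each free entry after a shorter prefix of length k contributes a factor q,
-- which gives q^(2m - k). When m = n + 1 the matrix has only m columns and every x qualifies.

module Submission where

open import Defs
open import Level using (Level)
open import Data.Empty using (⊥-elim)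
open import Data.Unit using (⊤; tt)
open import Data.Product using (Σ; _×_; _,_; proj₁; proj₂)
open import Data.Product.Function.NonDependent.Propositional using (_×-⇔_)
open import Data.Sum using (_⊎_; inj₁; inj₂; [_,_]′)
import Data.Nat as Nat
open Nat using (ℕ; zero; suc; z≤n; s≤s)
import Data.Nat.Properties as ℕₚ
open import Data.Nat.Induction using (<-rec)
open import Data.Nat.Solver using (module +-*-Solver)
open import Data.Fin as Fin using (Fin; punchIn; punchOut; toℕ; fromℕ<)
import Data.Fin.Properties as Finₚ
import Data.List as List
open List using (List; []; _∷_; _++_; map; length; take; drop; replicate)
import Data.List.Properties as ListP
open import Data.List.Membership.Propositional using (_∈_)
import Data.List.Membership.Propositional.Properties as MemP
open import Data.List.Relation.Unary.Any using (here; there)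
import Data.List.Relation.Unary.All as All
import Data.List.Relation.Unary.All.Properties as AllP
open import Data.List.Relation.Unary.AllPairs using ([]; _∷_)
open import Data.List.Relation.Unary.Unique.Propositional using (Unique)
import Data.List.Relation.Unary.Unique.Propositional.Properties as UniqueP
import Data.Vec as Vec
open Vec using (Vec; lookup; tabulate; toList)
import Data.Vec.Properties as VecP
open import Function using (_∘_)
open import Function.Bundles using (_⇔_; mk⇔; Equivalence; Inverse)
open import Function.Definitions using (Injective)
open import Function.Properties.Equivalence using () renaming (refl to ⇔-refl; sym to ⇔-sym; trans to ⇔-trans)
import Function.Related.Propositional as Related
open import Relation.Binary.PropositionalEquality
open import Relation.Binary.Definitions using (DecidableEquality; tri<; tri≈; tri>)
open import Relation.Nullary using (¬_; Dec; yes; no; ¬?)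
import Relation.Nullary.Decidable as Dec
open import Algebra.Bundles using (CommutativeRing)
open import Algebra.Structures using (IsCommutativeRing)
import Algebra.Properties.Ring as RingProperties
import Algebra.Properties.CommutativeSemigroup as CommutativeSemigroupProperties
import Algebra.Properties.Semiring.Sum as SemiringSum
import Algebra.Solver.CommutativeMonoid as CommutativeMonoidSolver

module FieldProperties {c : Level} (F : Field c) where
  open Field F public
  open IsCommutativeRing isCommutativeRing public
    using (+-assoc; +-comm; *-assoc; *-comm; +-identityˡ; +-identityʳ;
           *-identityˡ; *-identityʳ; distribˡ; zeroˡ; zeroʳ; -‿inverseˡ; -‿inverseʳ)

  commutativeRing : CommutativeRing c c
  commutativeRing = record { isCommutativeRing = isCommutativeRing }

  open RingProperties (CommutativeRing.ring commutativeRing) public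
    using (-‿distribˡ-*; -‿distribʳ-*; -‿involutive)
  open CommutativeSemigroupProperties (CommutativeRing.*-commutativeSemigroup commutativeRing) public
    using () renaming (x∙yz≈y∙xz to x*[y*z]≡y*[x*z])
  open CommutativeSemigroupProperties (CommutativeRing.+-commutativeSemigroup commutativeRing) public
    using () renaming (interchange to +-interchange)
  open CommutativeMonoidSolver (CommutativeRing.*-commutativeMonoid commutativeRing) public
    using (_⊜_; _⊕_) renaming (solve to *-solve)
  private
    module Sum = SemiringSum (CommutativeRing.semiring commutativeRing)
  open ≡-Reasoning

  inv : (x : Carrier) → x ≢ 0# → Carrier
  inv x x≢0 = proj₁ (inverse x x≢0)

  *-inverseʳ : ∀ x (x≢0 : x ≢ 0#) → x * inv x x≢0 ≡ 1#
  *-inverseʳ x x≢0 = proj₂ (inverse x x≢0)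

  *-inverseˡ : ∀ x (x≢0 : x ≢ 0#) → inv x x≢0 * x ≡ 1#
  *-inverseˡ x x≢0 = trans (*-comm _ _) (*-inverseʳ x x≢0)

  1≢0 : 1# ≢ 0#
  1≢0 1≡0 = 0≢1 (sym 1≡0)

  x*y≡0⇒y≡0 : ∀ {x y} → x ≢ 0# → x * y ≡ 0# → y ≡ 0#
  x*y≡0⇒y≡0 {x} {y} x≢0 xy≡0 = begin
    y                     ≡⟨ sym (*-identityˡ y) ⟩
    1# * y                ≡⟨ cong (_* y) (sym (*-inverseˡ x x≢0)) ⟩
    (inv x x≢0 * x) * y   ≡⟨ *-assoc _ _ _ ⟩
    inv x x≢0 * (x * y)   ≡⟨ cong (inv x x≢0 *_) xy≡0 ⟩
    inv x x≢0 * 0#        ≡⟨ zeroʳ _ ⟩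
    0#                    ∎

  x≢0∧y≢0⇒x*y≢0 : ∀ {x y} → x ≢ 0# → y ≢ 0# → x * y ≢ 0#
  x≢0∧y≢0⇒x*y≢0 x≢0 y≢0 xy≡0 = y≢0 (x*y≡0⇒y≡0 x≢0 xy≡0)

  x+y≡0⇒x≡-y : ∀ {x y} → x + y ≡ 0# → x ≡ - y
  x+y≡0⇒x≡-y {x} {y} x+y≡0 = begin
    x                ≡⟨ sym (+-identityʳ x) ⟩
    x + 0#           ≡⟨ cong (x +_) (sym (-‿inverseʳ y)) ⟩
    x + (y + - y)    ≡⟨ sym (+-assoc _ _ _) ⟩
    (x + y) + - y    ≡⟨ cong (_+ - y) x+y≡0 ⟩
    0# + - y         ≡⟨ +-identityˡ _ ⟩
    - y              ∎

  -x*y≡-[x*y] : ∀ x y → - x * y ≡ - (x * y)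
  -x*y≡-[x*y] x y = sym (-‿distribˡ-* x y)

  x*-y≡-[x*y] : ∀ x y → x * - y ≡ - (x * y)
  x*-y≡-[x*y] x y = sym (-‿distribʳ-* x y)

  -x*-y≡x*y : ∀ x y → - x * - y ≡ x * y
  -x*-y≡x*y x y = trans (-x*y≡-[x*y] x (- y)) (trans (cong -_ (x*-y≡-[x*y] x y)) (-‿involutive _))

  ∑≡sum : ∀ {r} (f : Fin r → Carrier) → ∑ F f ≡ Sum.sum f
  ∑≡sum {zero}  f = refl
  ∑≡sum {suc r} f = cong (f Fin.zero +_) (∑≡sum (λ t → f (Fin.suc t)))

  ∑-cong : ∀ {r} {f g : Fin r → Carrier} → (∀ t → f t ≡ g t) → ∑ F f ≡ ∑ F g
  ∑-cong {f = f} {g} f≗g = trans (∑≡sum f) (trans (Sum.sum-cong-≗ f≗g) (sym (∑≡sum g)))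

  ∑-zero : ∀ {r} {f : Fin r → Carrier} → (∀ t → f t ≡ 0#) → ∑ F f ≡ 0#
  ∑-zero {r} {f} f≗0 = trans (∑-cong {g = λ _ → 0#} f≗0) (trans (∑≡sum {r} (λ _ → 0#)) (Sum.sum-replicate-zero r))

  ∑-distrib-+ : ∀ {r} (f g : Fin r → Carrier) → ∑ F (λ t → f t + g t) ≡ ∑ F f + ∑ F g
  ∑-distrib-+ f g = begin
    ∑ F (λ t → f t + g t)     ≡⟨ ∑≡sum (λ t → f t + g t) ⟩
    Sum.sum (λ t → f t + g t) ≡⟨ Sum.∑-distrib-+ f g ⟩
    Sum.sum f + Sum.sum g     ≡⟨ sym (cong₂ _+_ (∑≡sum f) (∑≡sum g)) ⟩
    ∑ F f + ∑ F g             ∎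

  ∑-*ˡ : ∀ {r} x (f : Fin r → Carrier) → ∑ F (λ t → x * f t) ≡ x * ∑ F f
  ∑-*ˡ x f = trans (∑≡sum (λ t → x * f t)) (trans (sym (Sum.*-distribˡ-sum x f)) (cong (x *_) (sym (∑≡sum f))))

  ∑-comm : ∀ {r s} (f : Fin r → Fin s → Carrier) →
           ∑ F (λ t → ∑ F (f t)) ≡ ∑ F (λ i → ∑ F (λ t → f t i))
  ∑-comm f = begin
    ∑ F (λ t → ∑ F (f t))                   ≡⟨ ∑-cong (λ t → ∑≡sum (f t)) ⟩
    ∑ F (λ t → Sum.sum (f t))               ≡⟨ ∑≡sum (λ t → Sum.sum (f t)) ⟩
    Sum.sum (λ t → Sum.sum (f t))           ≡⟨ Sum.∑-comm f ⟩
    Sum.sum (λ i → Sum.sum (λ t → f t i))   ≡⟨ sym (∑≡sum (λ i → Sum.sum (λ t → f t i))) ⟩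
    ∑ F (λ i → Sum.sum (λ t → f t i))       ≡⟨ ∑-cong (λ i → sym (∑≡sum (λ t → f t i))) ⟩
    ∑ F (λ i → ∑ F (λ t → f t i))           ∎

  ∑-remove : ∀ {r} (t₀ : Fin (suc r)) (f : Fin (suc r) → Carrier) →
             ∑ F f ≡ f t₀ + ∑ F (λ t → f (punchIn t₀ t))
  ∑-remove t₀ f = begin
    ∑ F f                                       ≡⟨ ∑≡sum f ⟩
    Sum.sum f                                   ≡⟨ Sum.sum-remove f ⟩
    f t₀ + Sum.sum (λ t → f (punchIn t₀ t))     ≡⟨ cong (f t₀ +_) (sym (∑≡sum (λ t → f (punchIn t₀ t)))) ⟩
    f t₀ + ∑ F (λ t → f (punchIn t₀ t))         ∎

module LinearAlgebra {c : Level} (F : Field c) (_≟_ : DecidableEquality (Field.Carrier F)) where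
  open FieldProperties F
  open Nat using (_≤_)
  open ≡-Reasoning

  LinearlyIndependent : ∀ {d r} → (Fin r → (Fin d → Carrier)) → Set c
  LinearlyIndependent {r = r} v =
    ∀ (λs : Fin r → Carrier) → (∀ i → ∑ F (λ t → λs t * v t i) ≡ 0#) → ∀ t → λs t ≡ 0#

  HasIndependentColumns : ∀ {p s} → (Fin p → Fin s → Carrier) → Set c
  HasIndependentColumns {p} {s} A =
    Σ (Fin p → Fin s) λ cols → Injective _≡_ _≡_ cols × LinearlyIndependent (λ t → column F A (cols t))

  ∑-*-minus : ∀ {r} (w x y : Fin r → Carrier) z →
              ∑ F (λ i → w i * (x i + - (y i * z))) ≡ ∑ F (λ i → w i * x i) + - z * ∑ F (λ i → w i * y i)
  ∑-*-minus w x y z = begin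
    ∑ F (λ i → w i * (x i + - (y i * z)))               ≡⟨ ∑-cong pointwise ⟩
    ∑ F (λ i → w i * x i + - z * (w i * y i))           ≡⟨ ∑-distrib-+ (λ i → w i * x i) (λ i → - z * (w i * y i)) ⟩
    ∑ F (λ i → w i * x i) + ∑ F (λ i → - z * (w i * y i))
                                                        ≡⟨ cong (∑ F (λ i → w i * x i) +_) (∑-*ˡ (- z) (λ i → w i * y i)) ⟩
    ∑ F (λ i → w i * x i) + - z * ∑ F (λ i → w i * y i) ∎
    where
    pointwise : ∀ i → w i * (x i + - (y i * z)) ≡ w i * x i + - z * (w i * y i)
    pointwise i = begin
      w i * (x i + - (y i * z))           ≡⟨ distribˡ _ _ _ ⟩
      w i * x i + w i * - (y i * z)       ≡⟨ cong (w i * x i +_) (x*-y≡-[x*y] _ _) ⟩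
      w i * x i + - (w i * (y i * z))     ≡⟨ cong (λ u → w i * x i + - u) (*-solve 3 (λ w y z → (w ⊕ (y ⊕ z)) ⊜ (z ⊕ (w ⊕ y))) refl (w i) (y i) z) ⟩
      w i * x i + - (z * (w i * y i))     ≡⟨ cong (w i * x i +_) (sym (-x*y≡-[x*y] _ _)) ⟩
      w i * x i + - z * (w i * y i)       ∎

  module Elimination {p s} (A : Fin (suc p) → Fin (suc s) → Carrier)
                     (j₀ : Fin (suc s)) (pivot≢0 : A Fin.zero j₀ ≢ 0#) where
    pivot α : Carrier
    pivot = A Fin.zero j₀
    α = inv pivot pivot≢0

    others : Fin s → Fin (suc s)
    others = punchIn j₀

    reduced : Fin p → Fin s → Carrier
    reduced i t = A (Fin.suc i) (others t) + - (A (Fin.suc i) j₀ * (A Fin.zero (others t) * α))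

    dependent-rows : LinearlyDependent F reduced → LinearlyDependent F A
    dependent-rows (w′ , (i₁ , w′ᵢ₁≢0) , w′reduced≡0) = w , (Fin.suc i₁ , w′ᵢ₁≢0) , wA≡0
      where
      S = ∑ F (λ i → w′ i * A (Fin.suc i) j₀)
      w : Fin (suc p) → Carrier
      w Fin.zero    = - (S * α)
      w (Fin.suc i) = w′ i
      pivot-column : - (S * α) * pivot + S ≡ 0#
      pivot-column = begin
        - (S * α) * pivot + S   ≡⟨ cong (_+ S) (-x*y≡-[x*y] _ _) ⟩
        - (S * α * pivot) + S   ≡⟨ cong (λ u → - u + S) (*-assoc _ _ _) ⟩
        - (S * (α * pivot)) + S ≡⟨ cong (λ u → - (S * u) + S) (*-inverseˡ _ pivot≢0) ⟩
        - (S * 1#) + S          ≡⟨ cong (λ u → - u + S) (*-identityʳ _) ⟩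
        - S + S                 ≡⟨ -‿inverseˡ _ ⟩
        0#                      ∎
      other-column : ∀ t → - (S * α) * A Fin.zero (others t) + ∑ F (λ i → w′ i * A (Fin.suc i) (others t)) ≡ 0#
      other-column t = begin
        - (S * α) * Z + ∑ F (λ i → w′ i * A (Fin.suc i) (others t)) ≡⟨ cong (- (S * α) * Z +_) rest ⟩
        - (S * α) * Z + - - ((Z * α) * S)                           ≡⟨ cong₂ _+_ (-x*y≡-[x*y] _ _) (-‿involutive _) ⟩
        - (S * α * Z) + (Z * α) * S                                 ≡⟨ cong (- (S * α * Z) +_) (*-solve 3 (λ S Z α → ((Z ⊕ α) ⊕ S) ⊜ ((S ⊕ α) ⊕ Z)) refl S Z α) ⟩
        - (S * α * Z) + S * α * Z                                   ≡⟨ -‿inverseˡ _ ⟩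
        0#                                                          ∎
        where
        Z = A Fin.zero (others t)
        rest : ∑ F (λ i → w′ i * A (Fin.suc i) (others t)) ≡ - - ((Z * α) * S)
        rest = trans (x+y≡0⇒x≡-y (trans (sym (∑-*-minus w′ _ _ (Z * α))) (w′reduced≡0 t)))
                     (cong -_ (-x*y≡-[x*y] _ _))
      wA≡0 : ∀ j → ∑ F (λ i → w i * A i j) ≡ 0#
      wA≡0 j with j₀ Fin.≟ j
      ... | yes refl = pivot-column
      ... | no j₀≢j  = subst (λ j → ∑ F (λ i → w i * A i j) ≡ 0#) (Finₚ.punchIn-punchOut j₀≢j) (other-column (punchOut j₀≢j))

    pivot-cancels : ∀ μ y → - (μ * y) + - (y * α) * - (μ * pivot) ≡ 0#
    pivot-cancels μ y = begin
      - (μ * y) + - (y * α) * - (μ * pivot) ≡⟨ cong (- (μ * y) +_) (-x*-y≡x*y _ _) ⟩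
      - (μ * y) + (y * α) * (μ * pivot)     ≡⟨ cong (- (μ * y) +_) (*-solve 4 (λ μ y α a → ((y ⊕ α) ⊕ (μ ⊕ a)) ⊜ ((μ ⊕ y) ⊕ (α ⊕ a))) refl μ y α pivot) ⟩
      - (μ * y) + (μ * y) * (α * pivot)     ≡⟨ cong (λ u → - (μ * y) + (μ * y) * u) (*-inverseˡ _ pivot≢0) ⟩
      - (μ * y) + (μ * y) * 1#              ≡⟨ cong (- (μ * y) +_) (*-identityʳ _) ⟩
      - (μ * y) + μ * y                     ≡⟨ -‿inverseˡ _ ⟩
      0#                                    ∎

    extend : ∀ {r} → (Fin r → Fin s) → Fin (suc r) → Fin (suc s)
    extend cols′ Fin.zero    = j₀
    extend cols′ (Fin.suc t) = others (cols′ t)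

    extend-injective : ∀ {r} {cols′ : Fin r → Fin s} → Injective _≡_ _≡_ cols′ → Injective _≡_ _≡_ (extend cols′)
    extend-injective _         {Fin.zero}  {Fin.zero}  _ = refl
    extend-injective {cols′ = cols′} _ {Fin.zero}  {Fin.suc u} e = ⊥-elim (Finₚ.punchInᵢ≢i j₀ (cols′ u) (sym e))
    extend-injective {cols′ = cols′} _ {Fin.suc t} {Fin.zero}  e = ⊥-elim (Finₚ.punchInᵢ≢i j₀ (cols′ t) e)
    extend-injective injective {Fin.suc t} {Fin.suc u} e = cong Fin.suc (injective (Finₚ.punchIn-injective j₀ _ _ e))

    independent-columns : HasIndependentColumns reduced → HasIndependentColumns A
    independent-columns (cols′ , cols′-injective , independent′) = extend cols′ , extend-injective cols′-injective , independent
      where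
      independent : LinearlyIndependent (λ t → column F A (extend cols′ t))
      independent λs λsA≡0 = λs≡0
        where
        μ = λs Fin.zero
        λ′ : Fin p → Carrier
        λ′ t = λs (Fin.suc t)
        row : ∀ i → ∑ F (λ t → λ′ t * A i (others (cols′ t))) ≡ - (μ * A i j₀)
        row i = x+y≡0⇒x≡-y (trans (+-comm _ _) (λsA≡0 i))
        λ′reduced≡0 : ∀ i → ∑ F (λ t → λ′ t * reduced i (cols′ t)) ≡ 0#
        λ′reduced≡0 i = begin
          ∑ F (λ t → λ′ t * reduced i (cols′ t))
            ≡⟨ ∑-cong (λ t → cong (λ u → λ′ t * (A (Fin.suc i) (others (cols′ t)) + - u)) (regroup (A Fin.zero (others (cols′ t))))) ⟩
          ∑ F (λ t → λ′ t * (A (Fin.suc i) (others (cols′ t)) + - (A Fin.zero (others (cols′ t)) * (y * α))))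
            ≡⟨ ∑-*-minus λ′ _ _ (y * α) ⟩
          ∑ F (λ t → λ′ t * A (Fin.suc i) (others (cols′ t))) + - (y * α) * ∑ F (λ t → λ′ t * A Fin.zero (others (cols′ t)))
            ≡⟨ cong₂ (λ u v → u + - (y * α) * v) (row (Fin.suc i)) (row Fin.zero) ⟩
          - (μ * y) + - (y * α) * - (μ * pivot)
            ≡⟨ pivot-cancels μ y ⟩
          0# ∎
          where
          y = A (Fin.suc i) j₀
          regroup : ∀ z → y * (z * α) ≡ z * (y * α)
          regroup z = *-solve 3 (λ y z α → (y ⊕ (z ⊕ α)) ⊜ (z ⊕ (y ⊕ α))) refl y z α
        λ′≡0 : ∀ t → λ′ t ≡ 0#
        λ′≡0 = independent′ λ′ λ′reduced≡0
        μ≡0 : μ ≡ 0#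
        μ≡0 = x*y≡0⇒y≡0 pivot≢0 (begin
          pivot * μ                                                    ≡⟨ *-comm _ _ ⟩
          μ * pivot                                                    ≡⟨ sym (+-identityʳ _) ⟩
          μ * pivot + 0#                                               ≡⟨ cong (μ * pivot +_) (sym (∑-zero (λ t → trans (cong (_* _) (λ′≡0 t)) (zeroˡ _)))) ⟩
          μ * pivot + ∑ F (λ t → λ′ t * A Fin.zero (others (cols′ t))) ≡⟨ λsA≡0 Fin.zero ⟩
          0#                                                           ∎)
        λs≡0 : ∀ t → λs t ≡ 0#
        λs≡0 Fin.zero    = μ≡0
        λs≡0 (Fin.suc t) = λ′≡0 t

  independentColumns⊎dependentRows : ∀ p s (A : Fin p → Fin s → Carrier) →
                                    HasIndependentColumns A ⊎ LinearlyDependent F A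
  independentColumns⊎dependentRows zero s A = inj₁ ((λ ()) , (λ {t} → ⊥-elim (Finₚ.¬Fin0 t)) , λ _ _ ())
  independentColumns⊎dependentRows (suc p) s A with Finₚ.any? (λ j → ¬? (A Fin.zero j ≟ 0#))
  ... | no first-row≡0 = inj₂ (e₀ , (Fin.zero , 1≢0) , e₀A≡0)
    where
    e₀ : Fin (suc p) → Carrier
    e₀ Fin.zero    = 1#
    e₀ (Fin.suc _) = 0#
    e₀A≡0 : ∀ j → ∑ F (λ i → e₀ i * A i j) ≡ 0#
    e₀A≡0 j with A Fin.zero j ≟ 0#
    ... | no A₀ⱼ≢0 = ⊥-elim (first-row≡0 (j , A₀ⱼ≢0))
    ... | yes A₀ⱼ≡0 = begin
      1# * A Fin.zero j + ∑ F (λ i → 0# * A (Fin.suc i) j) ≡⟨ cong₂ _+_ (trans (*-identityˡ _) A₀ⱼ≡0) (∑-zero (λ i → zeroˡ (A (Fin.suc i) j))) ⟩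
      0# + 0#                                            ≡⟨ +-identityˡ _ ⟩
      0#                                                 ∎
  independentColumns⊎dependentRows (suc p) zero    A | yes (() , _)
  independentColumns⊎dependentRows (suc p) (suc s) A | yes (j₀ , pivot≢0)
    with independentColumns⊎dependentRows p s (Elimination.reduced A j₀ pivot≢0)
  ... | inj₁ independent = inj₁ (Elimination.independent-columns A j₀ pivot≢0 independent)
  ... | inj₂ dependent   = inj₂ (Elimination.dependent-rows A j₀ pivot≢0 dependent)

  more-vectors-than-dimension⇒dependent : ∀ {d r} → d Nat.< r → (v : Fin r → Fin d → Carrier) → LinearlyDependent F v
  more-vectors-than-dimension⇒dependent d<r v with independentColumns⊎dependentRows _ _ v
  ... | inj₂ dependent = dependent
  ... | inj₁ (cols , cols-injective , _) with Finₚ.pigeonhole d<r cols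
  ...   | t , u , t<u , colsₜ≡colsᵤ = ⊥-elim (Finₚ.<⇒≢ t<u (cols-injective colsₜ≡colsᵤ))

  rankAtMost⇒dependentRows : ∀ {m s} (A : Fin (suc m) → Fin s → Carrier) → RankAtMost F m A → LinearlyDependent F A
  rankAtMost⇒dependentRows A rank≤m with independentColumns⊎dependentRows _ _ A
  ... | inj₂ dependent = dependent
  ... | inj₁ (cols , cols-injective , independent) with rank≤m cols cols-injective
  ...   | λs , (t , λₜ≢0) , λsA≡0 = ⊥-elim (λₜ≢0 (independent λs λsA≡0 t))

  ∑-*-factor : ∀ {r} (λs g : Fin r → Carrier) x → ∑ F (λ t → λs t * (x * g t)) ≡ x * ∑ F (λ t → λs t * g t)
  ∑-*-factor λs g x = trans (∑-cong (λ t → x*[y*z]≡y*[x*z] (λs t) x (g t))) (∑-*ˡ x (λ t → λs t * g t))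

  row-from-relation : ∀ {m s} (A : Fin (suc m) → Fin s → Carrier) (w : Fin (suc m) → Carrier) i₀ (wᵢ₀≢0 : w i₀ ≢ 0#) →
    (∀ j → ∑ F (λ i → w i * A i j) ≡ 0#) →
    ∀ j → A i₀ j ≡ - inv (w i₀) wᵢ₀≢0 * ∑ F (λ i → w (punchIn i₀ i) * A (punchIn i₀ i) j)
  row-from-relation A w i₀ wᵢ₀≢0 wA≡0 j = begin
    A i₀ j                ≡⟨ sym (*-identityˡ _) ⟩
    1# * A i₀ j           ≡⟨ cong (_* A i₀ j) (sym (*-inverseˡ _ wᵢ₀≢0)) ⟩
    β * w i₀ * A i₀ j     ≡⟨ *-assoc _ _ _ ⟩
    β * (w i₀ * A i₀ j)   ≡⟨ cong (β *_) (x+y≡0⇒x≡-y (trans (sym (∑-remove i₀ (λ i → w i * A i j))) (wA≡0 j))) ⟩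
    β * - R               ≡⟨ x*-y≡-[x*y] _ _ ⟩
    - (β * R)             ≡⟨ sym (-x*y≡-[x*y] _ _) ⟩
    - β * R               ∎
    where
    β = inv (w i₀) wᵢ₀≢0
    R = ∑ F (λ i → w (punchIn i₀ i) * A (punchIn i₀ i) j)

  relation-kills-combinations : ∀ {m r} (B : Fin m → Fin r → Carrier) (μ : Fin m → Carrier) (λs : Fin r → Carrier) →
    (∀ i → ∑ F (λ t → λs t * B i t) ≡ 0#) → ∑ F (λ t → λs t * ∑ F (λ i → μ i * B i t)) ≡ 0#
  relation-kills-combinations {m} B μ λs λsB≡0 = begin
    ∑ F (λ t → λs t * ∑ F (λ i → μ i * B i t))         ≡⟨ ∑-cong (λ t → sym (∑-*ˡ (λs t) (λ i → μ i * B i t))) ⟩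
    ∑ F (λ t → ∑ F (λ i → λs t * (μ i * B i t)))       ≡⟨ ∑-comm (λ t i → λs t * (μ i * B i t)) ⟩
    ∑ F (λ i → ∑ F (λ t → λs t * (μ i * B i t)))       ≡⟨ ∑-cong (λ i → ∑-*-factor λs (B i) (μ i)) ⟩
    ∑ F (λ i → μ i * ∑ F (λ t → λs t * B i t))         ≡⟨ ∑-zero (λ i → trans (cong (μ i *_) (λsB≡0 i)) (zeroʳ _)) ⟩
    0#                                                 ∎

  -- The m + 1 chosen columns, restricted to the m rows other than i₀, are dependent; row i₀ is a combination of those rows.
  dependentRows⇒rankAtMost : ∀ {m s} (A : Fin (suc m) → Fin s → Carrier) → LinearlyDependent F A → RankAtMost F m A
  dependentRows⇒rankAtMost {m} A (w , (i₀ , wᵢ₀≢0) , wA≡0) cols _ = λs , λs≢0 , λsA≡0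
    where
    others = punchIn i₀
    B : Fin m → Fin (suc m) → Carrier
    B i t = A (others i) (cols t)
    dependent : LinearlyDependent F (λ t i → B i t)
    dependent = more-vectors-than-dimension⇒dependent ℕₚ.≤-refl (λ t i → B i t)
    λs = proj₁ dependent
    λs≢0 = proj₁ (proj₂ dependent)
    λsB≡0 = proj₂ (proj₂ dependent)
    λsAᵢ₀≡0 : ∑ F (λ t → λs t * A i₀ (cols t)) ≡ 0#
    λsAᵢ₀≡0 = begin
      ∑ F (λ t → λs t * A i₀ (cols t))
        ≡⟨ ∑-cong (λ t → cong (λs t *_) (row-from-relation A w i₀ wᵢ₀≢0 wA≡0 (cols t))) ⟩
      ∑ F (λ t → λs t * (- β * ∑ F (λ i → w (others i) * B i t)))
        ≡⟨ ∑-*-factor λs (λ t → ∑ F (λ i → w (others i) * B i t)) (- β) ⟩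
      - β * ∑ F (λ t → λs t * ∑ F (λ i → w (others i) * B i t))
        ≡⟨ cong (- β *_) (relation-kills-combinations B (w ∘ others) λs λsB≡0) ⟩
      - β * 0#
        ≡⟨ zeroʳ _ ⟩
      0# ∎
      where
      β = inv (w i₀) wᵢ₀≢0
    λsA≡0 : ∀ i → ∑ F (λ t → λs t * A i (cols t)) ≡ 0#
    λsA≡0 i with i₀ Fin.≟ i
    ... | yes refl = λsAᵢ₀≡0
    ... | no i₀≢i  = subst (λ i → ∑ F (λ t → λs t * A i (cols t)) ≡ 0#) (Finₚ.punchIn-punchOut i₀≢i) (λsB≡0 (punchOut i₀≢i))

  LinearlyDependent-resp : ∀ {d r} {v w : Fin r → Fin d → Carrier} → (∀ t i → v t i ≡ w t i) →
                           LinearlyDependent F v → LinearlyDependent F w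
  LinearlyDependent-resp v≗w (λs , λs≢0 , λsv≡0) =
    λs , λs≢0 , λ i → trans (∑-cong (λ t → cong (λs t *_) (sym (v≗w t i)))) (λsv≡0 i)

  rankAtMost-columns : ∀ {p s ρ} (A : Fin p → Fin s → Carrier) → s ≤ ρ → RankAtMost F ρ A
  rankAtMost-columns A s≤ρ cols cols-injective with Finₚ.pigeonhole (s≤s s≤ρ) cols
  ... | t , u , t<u , colsₜ≡colsᵤ = ⊥-elim (Finₚ.<⇒≢ t<u (cols-injective colsₜ≡colsᵤ))

module PowerSeries {c : Level} (F : Field c) where
  open FieldProperties F renaming (_+_ to _⊹_)
  open Nat using (_+_; _∸_; _<_; _≤_; _≤?_; _<?_)
  open ≡-Reasoning

  Series : Set c
  Series = ℕ → Carrier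

  Σ< : ℕ → Series → Carrier
  Σ< zero    g = 0#
  Σ< (suc n) g = g 0 ⊹ Σ< n (λ i → g (suc i))

  ∑≡Σ< : ∀ n (g : Series) → ∑ F {n} (λ i → g (toℕ i)) ≡ Σ< n g
  ∑≡Σ< zero    g = refl
  ∑≡Σ< (suc n) g = cong (g 0 ⊹_) (∑≡Σ< n (λ i → g (suc i)))

  Σ<-cong : ∀ n {g h : Series} → (∀ i → i < n → g i ≡ h i) → Σ< n g ≡ Σ< n h
  Σ<-cong zero    g≗h = refl
  Σ<-cong (suc n) g≗h = cong₂ _⊹_ (g≗h 0 (s≤s z≤n)) (Σ<-cong n (λ i i<n → g≗h (suc i) (s≤s i<n)))

  Σ<-zero : ∀ n {g : Series} → (∀ i → i < n → g i ≡ 0#) → Σ< n g ≡ 0#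
  Σ<-zero zero    g≗0 = refl
  Σ<-zero (suc n) g≗0 = trans (cong₂ _⊹_ (g≗0 0 (s≤s z≤n)) (Σ<-zero n (λ i i<n → g≗0 (suc i) (s≤s i<n)))) (+-identityˡ _)

  Σ<-distrib-⊹ : ∀ n (g h : Series) → Σ< n (λ i → g i ⊹ h i) ≡ Σ< n g ⊹ Σ< n h
  Σ<-distrib-⊹ zero    g h = sym (+-identityˡ _)
  Σ<-distrib-⊹ (suc n) g h =
    trans (cong ((g 0 ⊹ h 0) ⊹_) (Σ<-distrib-⊹ n (λ i → g (suc i)) (λ i → h (suc i)))) (+-interchange _ _ _ _)

  Σ<-*ˡ : ∀ n x (g : Series) → Σ< n (λ i → x * g i) ≡ x * Σ< n g
  Σ<-*ˡ zero    x g = sym (zeroʳ x)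
  Σ<-*ˡ (suc n) x g = trans (cong (x * g 0 ⊹_) (Σ<-*ˡ n x (λ i → g (suc i)))) (sym (distribˡ _ _ _))

  Σ<-comm : ∀ n m (g : ℕ → ℕ → Carrier) → Σ< n (λ a → Σ< m (g a)) ≡ Σ< m (λ i → Σ< n (λ a → g a i))
  Σ<-comm zero    m g = sym (Σ<-zero m (λ _ _ → refl))
  Σ<-comm (suc n) m g = trans (cong (Σ< m (g 0) ⊹_) (Σ<-comm n m (λ a → g (suc a))))
                              (sym (Σ<-distrib-⊹ m (g 0) (λ i → Σ< n (λ a → g (suc a) i))))

  Σ<-snoc : ∀ n (g : Series) → Σ< (suc n) g ≡ Σ< n g ⊹ g n
  Σ<-snoc zero    g = trans (+-identityʳ _) (sym (+-identityˡ _))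
  Σ<-snoc (suc n) g = trans (cong (g 0 ⊹_) (Σ<-snoc n (λ i → g (suc i)))) (sym (+-assoc _ _ _))

  Σ<-split : ∀ a b (g : Series) → Σ< (a + b) g ≡ Σ< a g ⊹ Σ< b (λ i → g (a + i))
  Σ<-split zero    b g = sym (+-identityˡ _)
  Σ<-split (suc a) b g = trans (cong (g 0 ⊹_) (Σ<-split a b (λ i → g (suc i)))) (sym (+-assoc _ _ _))

  Σ<-reverse : ∀ n (g : Series) → Σ< n g ≡ Σ< n (λ i → g (n ∸ suc i))
  Σ<-reverse zero    g = refl
  Σ<-reverse (suc n) g = begin
    Σ< (suc n) g                          ≡⟨ Σ<-snoc n g ⟩
    Σ< n g ⊹ g n                          ≡⟨ cong (_⊹ g n) (Σ<-reverse n g) ⟩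
    Σ< n (λ i → g (n ∸ suc i)) ⊹ g n      ≡⟨ +-comm _ _ ⟩
    g n ⊹ Σ< n (λ i → g (n ∸ suc i))      ∎

  Σ<-single : ∀ n k (g : Series) → k < n → (∀ i → i < n → i ≢ k → g i ≡ 0#) → Σ< n g ≡ g k
  Σ<-single (suc n) zero    g _ g≡0 =
    trans (cong (g 0 ⊹_) (Σ<-zero n (λ i i<n → g≡0 (suc i) (s≤s i<n) (λ ())))) (+-identityʳ _)
  Σ<-single (suc n) (suc k) g (s≤s k<n) g≡0 =
    trans (cong₂ _⊹_ (g≡0 0 (s≤s z≤n) (λ ()))
                     (Σ<-single n k (λ i → g (suc i)) k<n (λ i i<n i≢k → g≡0 (suc i) (s≤s i<n) (i≢k ∘ ℕₚ.suc-injective))))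
          (+-identityˡ _)

  when : ∀ {ℓ} {P : Set ℓ} → Dec P → Carrier → Carrier
  when (yes _) x = x
  when (no _)  _ = 0#

  when-yes : ∀ {ℓ} {P : Set ℓ} (d : Dec P) x → P → when d x ≡ x
  when-yes (yes _) x _ = refl
  when-yes (no ¬p) x p = ⊥-elim (¬p p)

  when-no : ∀ {ℓ} {P : Set ℓ} (d : Dec P) x → ¬ P → when d x ≡ 0#
  when-no (yes p) x ¬p = ⊥-elim (¬p p)
  when-no (no _)  x _  = refl

  Σ<-extend : ∀ a k (g : Series) → Σ< (suc a) g ≡ Σ< (suc a + k) (λ i → when (i ≤? a) (g i))
  Σ<-extend a k g = sym (begin
    Σ< (suc a + k) (λ i → when (i ≤? a) (g i))
      ≡⟨ Σ<-split (suc a) k (λ i → when (i ≤? a) (g i)) ⟩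
    Σ< (suc a) (λ i → when (i ≤? a) (g i)) ⊹ Σ< k (λ i → when (suc a + i ≤? a) (g (suc a + i)))
      ≡⟨ cong₂ _⊹_ (Σ<-cong (suc a) (λ i i≤a → when-yes (i ≤? a) (g i) (ℕₚ.≤-pred i≤a)))
                   (Σ<-zero k (λ i _ → when-no (suc a + i ≤? a) _ (ℕₚ.m+n≮m a i))) ⟩
    Σ< (suc a) g ⊹ 0#
      ≡⟨ +-identityʳ _ ⟩
    Σ< (suc a) g ∎)

  infixl 7 _⋆_

  _⋆_ : Series → Series → Series
  (u ⋆ v) s = Σ< (suc s) (λ i → u i * v (s ∸ i))

  one : Series
  one zero    = 1#
  one (suc _) = 0#

  ⋆-cong : ∀ s {u u′ v v′ : Series} → (∀ i → i ≤ s → u i ≡ u′ i) → (∀ i → i ≤ s → v i ≡ v′ i) →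
           (u ⋆ v) s ≡ (u′ ⋆ v′) s
  ⋆-cong s u≗u′ v≗v′ = Σ<-cong (suc s) (λ i i≤s → cong₂ _*_ (u≗u′ i (ℕₚ.≤-pred i≤s)) (v≗v′ (s ∸ i) (ℕₚ.m∸n≤m s i)))

  ⋆-comm : ∀ u v s → (u ⋆ v) s ≡ (v ⋆ u) s
  ⋆-comm u v s = begin
    (u ⋆ v) s                                         ≡⟨ Σ<-reverse (suc s) (λ i → u i * v (s ∸ i)) ⟩
    Σ< (suc s) (λ i → u (s ∸ i) * v (s ∸ (s ∸ i)))    ≡⟨ Σ<-cong (suc s) (λ i i≤s → trans (*-comm _ _)
                                                           (cong (λ j → v j * u (s ∸ i)) (ℕₚ.m∸[m∸n]≡n (ℕₚ.≤-pred i≤s)))) ⟩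
    (v ⋆ u) s                                         ∎

  ⋆-identityˡ : ∀ u s → (one ⋆ u) s ≡ u s
  ⋆-identityˡ u s = trans (cong₂ _⊹_ (*-identityˡ _) (Σ<-zero s (λ i _ → zeroˡ _))) (+-identityʳ _)

  ⋆-identityʳ : ∀ u s → (u ⋆ one) s ≡ u s
  ⋆-identityʳ u s = trans (⋆-comm u one s) (⋆-identityˡ u s)

  ⋆-assoc : ∀ u v w s → ((u ⋆ v) ⋆ w) s ≡ (u ⋆ (v ⋆ w)) s
  ⋆-assoc u v w s = begin
    ((u ⋆ v) ⋆ w) s                               ≡⟨ Σ<-cong (suc s) (λ a a≤s → outer a (ℕₚ.≤-pred a≤s)) ⟩
    Σ< (suc s) (λ a → Σ< (suc s) (λ i → T i a))   ≡⟨ Σ<-comm (suc s) (suc s) (λ a i → T i a) ⟩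
    Σ< (suc s) (λ i → Σ< (suc s) (λ a → T i a))   ≡⟨ Σ<-cong (suc s) (λ i i≤s → inner i (ℕₚ.≤-pred i≤s)) ⟩
    (u ⋆ (v ⋆ w)) s                               ∎
    where
    T : ℕ → ℕ → Carrier
    T i a = when (i ≤? a) (u i * v (a ∸ i) * w (s ∸ a))
    outer : ∀ a → a ≤ s → (u ⋆ v) a * w (s ∸ a) ≡ Σ< (suc s) (λ i → T i a)
    outer a a≤s = begin
      (u ⋆ v) a * w (s ∸ a)                               ≡⟨ *-comm _ _ ⟩
      w (s ∸ a) * (u ⋆ v) a                               ≡⟨ sym (Σ<-*ˡ (suc a) (w (s ∸ a)) (λ i → u i * v (a ∸ i))) ⟩
      Σ< (suc a) (λ i → w (s ∸ a) * (u i * v (a ∸ i)))    ≡⟨ Σ<-cong (suc a) (λ i _ → *-comm (w (s ∸ a)) (u i * v (a ∸ i))) ⟩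
      Σ< (suc a) (λ i → u i * v (a ∸ i) * w (s ∸ a))      ≡⟨ Σ<-extend a (s ∸ a) (λ i → u i * v (a ∸ i) * w (s ∸ a)) ⟩
      Σ< (suc a + (s ∸ a)) (λ i → T i a)                  ≡⟨ cong (λ n → Σ< (suc n) (λ i → T i a)) (ℕₚ.m+[n∸m]≡n a≤s) ⟩
      Σ< (suc s) (λ i → T i a)                            ∎
    inner : ∀ i → i ≤ s → Σ< (suc s) (λ a → T i a) ≡ u i * (v ⋆ w) (s ∸ i)
    inner i i≤s = begin
      Σ< (suc s) (λ a → T i a)
        ≡⟨ cong (λ n → Σ< n (λ a → T i a)) (sym (trans (ℕₚ.+-suc i (s ∸ i)) (cong suc (ℕₚ.m+[n∸m]≡n i≤s)))) ⟩
      Σ< (i + suc (s ∸ i)) (λ a → T i a)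
        ≡⟨ Σ<-split i (suc (s ∸ i)) (λ a → T i a) ⟩
      Σ< i (λ a → T i a) ⊹ Σ< (suc (s ∸ i)) (λ b → T i (i + b))
        ≡⟨ cong₂ _⊹_ (Σ<-zero i (λ a a<i → when-no (i ≤? a) _ (ℕₚ.<⇒≱ a<i)))
                     (Σ<-cong (suc (s ∸ i)) (λ b _ → T-shifted b)) ⟩
      0# ⊹ Σ< (suc (s ∸ i)) (λ b → u i * (v b * w (s ∸ i ∸ b)))
        ≡⟨ +-identityˡ _ ⟩
      Σ< (suc (s ∸ i)) (λ b → u i * (v b * w (s ∸ i ∸ b)))
        ≡⟨ Σ<-*ˡ (suc (s ∸ i)) (u i) (λ b → v b * w (s ∸ i ∸ b)) ⟩
      u i * (v ⋆ w) (s ∸ i) ∎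
      where
      T-shifted : ∀ b → T i (i + b) ≡ u i * (v b * w (s ∸ i ∸ b))
      T-shifted b = begin
        T i (i + b)                                ≡⟨ when-yes (i ≤? i + b) _ (ℕₚ.m≤m+n i b) ⟩
        u i * v (i + b ∸ i) * w (s ∸ (i + b))      ≡⟨ cong₂ (λ j k → u i * v j * w k) (ℕₚ.m+n∸m≡n i b) (sym (ℕₚ.∸-+-assoc s i b)) ⟩
        u i * v b * w (s ∸ i ∸ b)                  ≡⟨ *-assoc _ _ _ ⟩
        u i * (v b * w (s ∸ i ∸ b))                ∎

  AgreeBelow : ℕ → Series → Series → Set c
  AgreeBelow l u v = ∀ i → i < l → u i ≡ v i

  ⋆-agree : ∀ {l u u′ v v′} → AgreeBelow l u u′ → AgreeBelow l v v′ → AgreeBelow l (u ⋆ v) (u′ ⋆ v′)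
  ⋆-agree u≈u′ v≈v′ s s<l =
    ⋆-cong s (λ i i≤s → u≈u′ i (ℕₚ.≤-<-trans i≤s s<l)) (λ i i≤s → v≈v′ i (ℕₚ.≤-<-trans i≤s s<l))

  ⋆-agreeˡ : ∀ {l u u′} v → AgreeBelow l u u′ → AgreeBelow l (u ⋆ v) (u′ ⋆ v)
  ⋆-agreeˡ v u≈u′ = ⋆-agree {v = v} u≈u′ (λ _ _ → refl)

  ⋆-agreeʳ : ∀ {l v v′} u → AgreeBelow l v v′ → AgreeBelow l (u ⋆ v) (u ⋆ v′)
  ⋆-agreeʳ u v≈v′ = ⋆-agree {u = u} (λ _ _ → refl) v≈v′

  reciprocal-unique : ∀ {l f f′ g g′} → AgreeBelow l (f ⋆ g) one → AgreeBelow l (f′ ⋆ g′) one →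
                   AgreeBelow l f f′ → AgreeBelow l g g′
  reciprocal-unique {l} {f} {f′} {g} {g′} fg≈1 f′g′≈1 f≈f′ s s<l = begin
    g s                  ≡⟨ sym (⋆-identityʳ g s) ⟩
    (g ⋆ one) s          ≡⟨ ⋆-agreeʳ g (λ i i<l → sym (f′g′≈1 i i<l)) s s<l ⟩
    (g ⋆ (f′ ⋆ g′)) s    ≡⟨ sym (⋆-assoc g f′ g′ s) ⟩
    ((g ⋆ f′) ⋆ g′) s    ≡⟨ ⋆-agreeˡ g′ (⋆-agreeʳ g (λ i i<l → sym (f≈f′ i i<l))) s s<l ⟩
    ((g ⋆ f) ⋆ g′) s     ≡⟨ ⋆-agreeˡ g′ (λ i _ → ⋆-comm g f i) s s<l ⟩
    ((f ⋆ g) ⋆ g′) s     ≡⟨ ⋆-agreeˡ g′ fg≈1 s s<l ⟩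
    (one ⋆ g′) s         ≡⟨ ⋆-identityˡ g′ s ⟩
    g′ s                 ∎

  module Reciprocal (f : Series) (f₀≢0 : f 0 ≢ 0#) where
    private
      β : Carrier
      β = inv (f 0) f₀≢0

      next : ℕ → Series → Carrier
      next n g = β * (one n ⊹ - Σ< n (λ i → f (suc i) * g (n ∸ suc i)))

      -- approximation n already has the correct coefficients below n.
      approximation : ℕ → Series
      approximation zero    _ = 0#
      approximation (suc n) k with k <? n
      ... | yes _ = approximation n k
      ... | no _  = next n (approximation n)

      approximation-step : ∀ n k → k < n → approximation (suc n) k ≡ approximation n k
      approximation-step n k k<n with k <? n
      ... | yes _  = refl
      ... | no k≮n = ⊥-elim (k≮n k<n)

      approximation-stable : ∀ n d k → k < n → approximation (d + n) k ≡ approximation n k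
      approximation-stable n zero    k k<n = refl
      approximation-stable n (suc d) k k<n =
        trans (approximation-step (d + n) k (ℕₚ.≤-trans k<n (ℕₚ.m≤n+m n d))) (approximation-stable n d k k<n)

    reciprocal : Series
    reciprocal k = approximation (suc k) k

    private
      approximation≡reciprocal : ∀ n k → k < n → approximation n k ≡ reciprocal k
      approximation≡reciprocal n k k<n = begin
        approximation n k                         ≡⟨ cong (λ n → approximation n k) (sym (ℕₚ.m∸n+n≡m k<n)) ⟩
        approximation (n ∸ suc k + suc k) k       ≡⟨ approximation-stable (suc k) (n ∸ suc k) k ℕₚ.≤-refl ⟩
        reciprocal k                                 ∎

      reciprocal-recurrence : ∀ n → reciprocal n ≡ next n reciprocal
      reciprocal-recurrence n with n <? n
      ... | yes n<n = ⊥-elim (ℕₚ.<-irrefl refl n<n)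
      ... | no _    = cong (λ x → β * (one n ⊹ - x))
                           (Σ<-cong n (λ i i<n → cong (f (suc i) *_)
                             (approximation≡reciprocal n (n ∸ suc i) (ℕₚ.∸-monoʳ-< {o = 0} (s≤s z≤n) i<n))))

    ⋆-reciprocalʳ : ∀ n → (f ⋆ reciprocal) n ≡ one n
    ⋆-reciprocalʳ n = begin
      f 0 * reciprocal n ⊹ X                     ≡⟨ cong (λ x → f 0 * x ⊹ X) (reciprocal-recurrence n) ⟩
      f 0 * (β * (one n ⊹ - X)) ⊹ X           ≡⟨ cong (_⊹ X) (sym (*-assoc _ _ _)) ⟩
      (f 0 * β) * (one n ⊹ - X) ⊹ X           ≡⟨ cong (λ x → x * (one n ⊹ - X) ⊹ X) (*-inverseʳ _ f₀≢0) ⟩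
      1# * (one n ⊹ - X) ⊹ X                  ≡⟨ cong (_⊹ X) (*-identityˡ _) ⟩
      (one n ⊹ - X) ⊹ X                       ≡⟨ +-assoc _ _ _ ⟩
      one n ⊹ (- X ⊹ X)                       ≡⟨ cong (one n ⊹_) (-‿inverseˡ X) ⟩
      one n ⊹ 0#                              ≡⟨ +-identityʳ _ ⟩
      one n                                   ∎
      where
      X = Σ< n (λ i → f (suc i) * reciprocal (n ∸ suc i))

    ⋆-reciprocalˡ : ∀ n → (reciprocal ⋆ f) n ≡ one n
    ⋆-reciprocalˡ n = trans (⋆-comm reciprocal f n) (⋆-reciprocalʳ n)

    reciprocal-head≢0 : reciprocal 0 ≢ 0#
    reciprocal-head≢0 reciprocal₀≡0 = 1≢0 (begin
      1#                    ≡⟨ sym (⋆-reciprocalʳ 0) ⟩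
      f 0 * reciprocal 0 ⊹ 0#  ≡⟨ cong (λ x → f 0 * x ⊹ 0#) reciprocal₀≡0 ⟩
      f 0 * 0# ⊹ 0#         ≡⟨ +-identityʳ _ ⟩
      f 0 * 0#              ≡⟨ zeroʳ _ ⟩
      0#                    ∎)

  open Reciprocal public using (reciprocal; ⋆-reciprocalʳ; ⋆-reciprocalˡ; reciprocal-head≢0)

module PadeConditions {c : Level} (F : Field c) (_≟_ : DecidableEquality (Field.Carrier F)) where
  open FieldProperties F renaming (_+_ to _⊹_)
  open PowerSeries F
  open Nat using (_+_; _∸_; _<_; _≤_; _≤?_)
  open ≡-Reasoning

  DegreeAtMost : ℕ → Series → Set c
  DegreeAtMost p C = ∀ i → p < i → C i ≡ 0#

  NonzeroUpTo : ℕ → Series → Set c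
  NonzeroUpTo p C = Σ ℕ λ i → i ≤ p × C i ≢ 0#

  -- A Padé-type condition; for p = R = m and N = m + n + 1 it says that the rows of H_{m,n}(f) are dependent.
  PadeCondition : ℕ → ℕ → ℕ → Series → Set c
  PadeCondition p R N f =
    Σ Series λ C → DegreeAtMost p C × NonzeroUpTo p C × (∀ s → R ≤ s → s < N → (C ⋆ f) s ≡ 0#)

  PadeCondition-resp : ∀ {p R N f f′} → AgreeBelow N f f′ → PadeCondition p R N f → PadeCondition p R N f′
  PadeCondition-resp {f = f} {f′} f≈f′ (C , deg , nz , C⋆f≡0) = C , deg , nz , λ s R≤s s<N →
    trans (⋆-agreeʳ C (λ i i<N → sym (f≈f′ i i<N)) s s<N) (C⋆f≡0 s R≤s s<N)

  PadeCondition-cong : ∀ {p R N f f′} → AgreeBelow N f f′ → PadeCondition p R N f ⇔ PadeCondition p R N f′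
  PadeCondition-cong f≈f′ = mk⇔ (PadeCondition-resp f≈f′) (PadeCondition-resp (λ i i<N → sym (f≈f′ i i<N)))

  ⋆-truncate : ∀ {p C} f s → DegreeAtMost p C → p ≤ s → (C ⋆ f) s ≡ Σ< (suc p) (λ i → C i * f (s ∸ i))
  ⋆-truncate {p} {C} f s deg p≤s = begin
    (C ⋆ f) s
      ≡⟨ cong (λ n → Σ< (suc n) (λ i → C i * f (s ∸ i))) (sym (ℕₚ.m+[n∸m]≡n p≤s)) ⟩
    Σ< (suc p + (s ∸ p)) (λ i → C i * f (s ∸ i))
      ≡⟨ Σ<-split (suc p) (s ∸ p) (λ i → C i * f (s ∸ i)) ⟩
    Σ< (suc p) (λ i → C i * f (s ∸ i)) ⊹ Σ< (s ∸ p) (λ i → C (suc p + i) * f (s ∸ (suc p + i)))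
      ≡⟨ cong (Σ< (suc p) (λ i → C i * f (s ∸ i)) ⊹_)
              (Σ<-zero (s ∸ p) (λ i _ → trans (cong (_* _) (deg (suc p + i) (s≤s (ℕₚ.m≤m+n p i)))) (zeroˡ _))) ⟩
    Σ< (suc p) (λ i → C i * f (s ∸ i)) ⊹ 0#
      ≡⟨ +-identityʳ _ ⟩
    Σ< (suc p) (λ i → C i * f (s ∸ i)) ∎

  shift : Series → Series
  shift f zero    = 0#
  shift f (suc k) = f k

  shiftBy : ℕ → Series → Series
  shiftBy zero    f = f
  shiftBy (suc j) f = shift (shiftBy j f)

  ⋆-shift : ∀ C f s → (C ⋆ shift f) (suc s) ≡ (C ⋆ f) s
  ⋆-shift C f s = begin
    (C ⋆ shift f) (suc s)
      ≡⟨ Σ<-snoc (suc s) (λ i → C i * shift f (suc s ∸ i)) ⟩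
    Σ< (suc s) (λ i → C i * shift f (suc s ∸ i)) ⊹ C (suc s) * shift f (suc s ∸ suc s)
      ≡⟨ cong₂ _⊹_ (Σ<-cong (suc s) (λ i i≤s → cong (λ k → C i * shift f k) (ℕₚ.+-∸-assoc 1 (ℕₚ.≤-pred i≤s))))
                   (trans (cong (λ k → C (suc s) * shift f k) (ℕₚ.n∸n≡0 (suc s))) (zeroʳ _)) ⟩
    (C ⋆ f) s ⊹ 0#
      ≡⟨ +-identityʳ _ ⟩
    (C ⋆ f) s ∎

  PadeCondition-shift : ∀ {p R N f} → PadeCondition p (suc R) (suc N) (shift f) ⇔ PadeCondition p R N f
  PadeCondition-shift {f = f} = mk⇔
    (λ (C , deg , nz , C⋆f≡0) → C , deg , nz , λ s R≤s s<N → trans (sym (⋆-shift C f s)) (C⋆f≡0 (suc s) (s≤s R≤s) (s≤s s<N)))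
    (λ (C , deg , nz , C⋆f≡0) → C , deg , nz , λ where
      (suc s) (s≤s R≤s) (s≤s s<N) → trans (⋆-shift C f s) (C⋆f≡0 s R≤s s<N))

  PadeCondition-shiftBy : ∀ j {p R N f} → PadeCondition p (j + R) (j + N) (shiftBy j f) ⇔ PadeCondition p R N f
  PadeCondition-shiftBy zero    = ⇔-refl
  PadeCondition-shiftBy (suc j) = ⇔-trans PadeCondition-shift (PadeCondition-shiftBy j)

  dropCoeffs : ℕ → Series → Series
  dropCoeffs d f k = f (d + k)

  ⋆-dropCoeffs : ∀ {p C} d f s → DegreeAtMost p C → p ≤ s → (C ⋆ dropCoeffs d f) s ≡ (C ⋆ f) (d + s)
  ⋆-dropCoeffs {p} {C} d f s deg p≤s = begin
    (C ⋆ dropCoeffs d f) s                       ≡⟨ ⋆-truncate (dropCoeffs d f) s deg p≤s ⟩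
    Σ< (suc p) (λ i → C i * f (d + (s ∸ i)))
      ≡⟨ Σ<-cong (suc p) (λ i i≤p → cong (λ k → C i * f k) (sym (ℕₚ.+-∸-assoc d (ℕₚ.≤-trans (ℕₚ.≤-pred i≤p) p≤s)))) ⟩
    Σ< (suc p) (λ i → C i * f (d + s ∸ i))       ≡⟨ sym (⋆-truncate f (d + s) deg (ℕₚ.≤-trans p≤s (ℕₚ.m≤n+m s d))) ⟩
    (C ⋆ f) (d + s)                              ∎

  PadeCondition-dropCoeffs : ∀ d {p R N f} → p ≤ R →
                             PadeCondition p (d + R) (d + N) f ⇔ PadeCondition p R N (dropCoeffs d f)
  PadeCondition-dropCoeffs d {p} {R} {N} {f} p≤R = mk⇔ drop⇒ drop⇐
    where
    drop⇒ : PadeCondition p (d + R) (d + N) f → PadeCondition p R N (dropCoeffs d f)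
    drop⇒ (C , deg , nz , C⋆f≡0) = C , deg , nz , λ s R≤s s<N →
      trans (⋆-dropCoeffs d f s deg (ℕₚ.≤-trans p≤R R≤s)) (C⋆f≡0 (d + s) (ℕₚ.+-monoʳ-≤ d R≤s) (ℕₚ.+-monoʳ-< d s<N))
    drop⇐ : PadeCondition p R N (dropCoeffs d f) → PadeCondition p (d + R) (d + N) f
    drop⇐ (C , deg , nz , C⋆f≡0) = C , deg , nz , vanish
      where
      vanish : ∀ s → d + R ≤ s → s < d + N → (C ⋆ f) s ≡ 0#
      vanish s d+R≤s s<d+N = begin
        (C ⋆ f) s                    ≡⟨ cong (C ⋆ f) (sym d+[s∸d]≡s) ⟩
        (C ⋆ f) (d + (s ∸ d))        ≡⟨ sym (⋆-dropCoeffs d f (s ∸ d) deg (ℕₚ.≤-trans p≤R R≤s∸d)) ⟩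
        (C ⋆ dropCoeffs d f) (s ∸ d) ≡⟨ C⋆f≡0 (s ∸ d) R≤s∸d s∸d<N ⟩
        0#                           ∎
        where
        d+[s∸d]≡s : d + (s ∸ d) ≡ s
        d+[s∸d]≡s = ℕₚ.m+[n∸m]≡n (ℕₚ.≤-trans (ℕₚ.m≤m+n d R) d+R≤s)
        R≤s∸d : R ≤ s ∸ d
        R≤s∸d = ℕₚ.+-cancelˡ-≤ d R (s ∸ d) (subst (d + R ≤_) (sym d+[s∸d]≡s) d+R≤s)
        s∸d<N : s ∸ d < N
        s∸d<N = ℕₚ.+-cancelˡ-< d (s ∸ d) N (subst (_< d + N) (sym d+[s∸d]≡s) s<d+N)

  first-nonzero-below : ∀ n (C : Series) →
    (Σ ℕ λ i → i < n × C i ≢ 0# × (∀ j → j < i → C j ≡ 0#)) ⊎ (∀ i → i < n → C i ≡ 0#)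
  first-nonzero-below zero    C = inj₂ (λ _ ())
  first-nonzero-below (suc n) C with first-nonzero-below n C
  ... | inj₁ (i , i<n , Cᵢ≢0 , below) = inj₁ (i , ℕₚ.m<n⇒m<1+n i<n , Cᵢ≢0 , below)
  ... | inj₂ C≡0 with C n ≟ 0#
  ...   | no Cₙ≢0 = inj₁ (n , ℕₚ.≤-refl , Cₙ≢0 , C≡0)
  ...   | yes Cₙ≡0 = inj₂ λ i i≤n → [ C≡0 i , (λ { refl → Cₙ≡0 }) ]′ (ℕₚ.m≤n⇒m<n∨m≡n (ℕₚ.≤-pred i≤n))

  -- The form for g is B = C ⋆ f truncated to degree R, because B ⋆ g ≡ C ⋆ f ⋆ g ≡ C below N.
  PadeCondition-reciprocal : ∀ {p R N f g} → AgreeBelow N (f ⋆ g) one → p < N → R < N →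
                             PadeCondition p (suc R) N f → PadeCondition R (suc p) N g
  PadeCondition-reciprocal {p} {R} {N} {f} {g} fg≈1 p<N R<N (C , degC , (i₀ , i₀≤p , Cᵢ₀≢0) , C⋆f≡0) =
    B , degB , nzB , λ s p<s s<N → trans (B⋆g≈C s s<N) (degC s p<s)
    where
    B : Series
    B i = when (i ≤? R) ((C ⋆ f) i)
    degB : DegreeAtMost R B
    degB i R<i = when-no (i ≤? R) _ (ℕₚ.<⇒≱ R<i)
    B≈C⋆f : AgreeBelow N B (C ⋆ f)
    B≈C⋆f i i<N with i ≤? R
    ... | yes _   = refl
    ... | no i≰R = sym (C⋆f≡0 i (ℕₚ.≰⇒> i≰R) i<N)
    B⋆g≈C : AgreeBelow N (B ⋆ g) C
    B⋆g≈C s s<N = begin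
      (B ⋆ g) s            ≡⟨ ⋆-agreeˡ g B≈C⋆f s s<N ⟩
      ((C ⋆ f) ⋆ g) s      ≡⟨ ⋆-assoc C f g s ⟩
      (C ⋆ (f ⋆ g)) s      ≡⟨ ⋆-agreeʳ C fg≈1 s s<N ⟩
      (C ⋆ one) s          ≡⟨ ⋆-identityʳ C s ⟩
      C s                  ∎
    nzB : NonzeroUpTo R B
    nzB with first-nonzero-below (suc R) B
    ... | inj₁ (i , i≤R , Bᵢ≢0 , _) = i , ℕₚ.≤-pred i≤R , Bᵢ≢0
    ... | inj₂ B≡0 = ⊥-elim (Cᵢ₀≢0 (begin
      C i₀          ≡⟨ sym (B⋆g≈C i₀ (ℕₚ.≤-<-trans i₀≤p p<N)) ⟩
      (B ⋆ g) i₀    ≡⟨ Σ<-zero (suc i₀) (λ i _ → trans (cong (_* g (i₀ ∸ i)) (B≡0′ i)) (zeroˡ _)) ⟩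
      0#            ∎))
      where
      B≡0′ : ∀ i → B i ≡ 0#
      B≡0′ i = [ (λ i≤R → B≡0 i (s≤s i≤R)) , (λ R<i → degB i R<i) ]′ (ℕₚ.≤-<-connex i R)

  PadeCondition-reciprocal⇔ : ∀ {p R N f g} → AgreeBelow N (f ⋆ g) one → p < N → R < N →
                              PadeCondition p (suc R) N f ⇔ PadeCondition R (suc p) N g
  PadeCondition-reciprocal⇔ {f = f} {g} fg≈1 p<N R<N = mk⇔
    (PadeCondition-reciprocal fg≈1 p<N R<N)
    (PadeCondition-reciprocal (λ i i<N → trans (⋆-comm g f i) (fg≈1 i i<N)) R<N p<N)


  vanishing⇒PadeCondition₀ : ∀ m n h → (∀ i → i < suc n ∸ m → h i ≡ 0#) → PadeCondition m 0 (suc n) h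
  vanishing⇒PadeCondition₀ m n h h≡0 = zᵐ , deg , (m , ℕₚ.≤-refl , zᵐₘ≢0) , zᵐ⋆h≡0
    where
    zᵐ : Series
    zᵐ i = when (i Nat.≟ m) 1#
    deg : DegreeAtMost m zᵐ
    deg i m<i = when-no (i Nat.≟ m) _ (λ i≡m → ℕₚ.<⇒≢ m<i (sym i≡m))
    zᵐₘ≢0 : zᵐ m ≢ 0#
    zᵐₘ≢0 zᵐₘ≡0 = 1≢0 (trans (sym (when-yes (m Nat.≟ m) 1# refl)) zᵐₘ≡0)
    term≡0 : ∀ s → s < suc n → ∀ i → i ≤ s → (i≟m : Dec (i ≡ m)) → when i≟m 1# * h (s ∸ i) ≡ 0#
    term≡0 s s<n i i≤s (yes refl) = trans (*-identityˡ _) (h≡0 (s ∸ m) (ℕₚ.∸-monoˡ-< s<n i≤s))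
    term≡0 s s<n i i≤s (no _)     = zeroˡ _
    zᵐ⋆h≡0 : ∀ s → 0 ≤ s → s < suc n → (zᵐ ⋆ h) s ≡ 0#
    zᵐ⋆h≡0 s _ s<n = Σ<-zero (suc s) (λ i i≤s → term≡0 s s<n i (ℕₚ.≤-pred i≤s) (i Nat.≟ m))

  -- The lowest nonzero coefficients of C and h give a nonzero coefficient of C ⋆ h inside the window.
  PadeCondition₀⇒vanishing : ∀ m n h → PadeCondition m 0 (suc n) h → ∀ i → i < suc n ∸ m → h i ≡ 0#
  PadeCondition₀⇒vanishing m n h (C , deg , (i₂ , i₂≤m , Cᵢ₂≢0) , C⋆h≡0)
    with first-nonzero-below (suc m) C | first-nonzero-below (suc n ∸ m) h
  ... | inj₂ C≡0 | _ = ⊥-elim (Cᵢ₂≢0 (C≡0 i₂ (s≤s i₂≤m)))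
  ... | inj₁ _   | inj₂ h≡0 = h≡0
  ... | inj₁ (i₁ , i₁≤m , Cᵢ₁≢0 , C-below) | inj₁ (i₀ , i₀<L , hᵢ₀≢0 , h-below) =
    ⊥-elim (x≢0∧y≢0⇒x*y≢0 Cᵢ₁≢0 hᵢ₀≢0 (trans (sym single-term) (C⋆h≡0 s z≤n s<n)))
    where
    s = i₀ + i₁
    m<n : m < suc n
    m<n = ℕₚ.≰⇒> (λ n<m → ℕₚ.n≮0 (subst (i₀ <_) (ℕₚ.m≤n⇒m∸n≡0 n<m) i₀<L))
    s<n : s < suc n
    s<n = ℕₚ.≤-trans (ℕₚ.+-monoʳ-≤ (suc i₀) (ℕₚ.≤-pred i₁≤m))
           (ℕₚ.≤-trans (ℕₚ.+-monoˡ-≤ m i₀<L) (ℕₚ.≤-reflexive (ℕₚ.m∸n+n≡m (ℕₚ.<⇒≤ m<n))))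
    s∸i₁≡i₀ : s ∸ i₁ ≡ i₀
    s∸i₁≡i₀ = ℕₚ.m+n∸n≡m i₀ i₁
    other-term≡0 : ∀ i → i < suc s → i ≢ i₁ → C i * h (s ∸ i) ≡ 0#
    other-term≡0 i i≤s i≢i₁ with ℕₚ.<-cmp i i₁
    ... | tri< i<i₁ _ _ = trans (cong (_* h (s ∸ i)) (C-below i i<i₁)) (zeroˡ _)
    ... | tri≈ _ i≡i₁ _ = ⊥-elim (i≢i₁ i≡i₁)
    ... | tri> _ _ i₁<i =
      trans (cong (C i *_) (h-below (s ∸ i) (subst (s ∸ i <_) s∸i₁≡i₀ (ℕₚ.∸-monoʳ-< i₁<i (ℕₚ.≤-pred i≤s))))) (zeroʳ _)
    single-term : (C ⋆ h) s ≡ C i₁ * h i₀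
    single-term = trans (Σ<-single (suc s) i₁ (λ i → C i * h (s ∸ i)) (s≤s (ℕₚ.m≤n+m i₁ i₀)) other-term≡0)
                        (cong (λ k → C i₁ * h k) s∸i₁≡i₀)

  PadeCondition₀⇔vanishing : ∀ m n h → PadeCondition m 0 (suc n) h ⇔ (∀ i → i < suc n ∸ m → h i ≡ 0#)
  PadeCondition₀⇔vanishing m n h = mk⇔ (PadeCondition₀⇒vanishing m n h) (vanishing⇒PadeCondition₀ m n h)

  hankel : ∀ m n → Series → Fin (suc m) → Fin (suc n) → Carrier
  hankel m n x i j = x (toℕ i + toℕ j)

  fromVector : ∀ {r} → (Fin r → Carrier) → Series
  fromVector {zero}  v k       = 0#
  fromVector {suc r} v zero    = v Fin.zero
  fromVector {suc r} v (suc k) = fromVector (λ i → v (Fin.suc i)) k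

  fromVector-toℕ : ∀ {r} (v : Fin r → Carrier) i → fromVector v (toℕ i) ≡ v i
  fromVector-toℕ v Fin.zero    = refl
  fromVector-toℕ v (Fin.suc i) = fromVector-toℕ (λ i → v (Fin.suc i)) i

  Σ<-reflect : ∀ m l (C x : Series) → Σ< (suc m) (λ i → C (m ∸ i) * x (m + l ∸ i)) ≡ Σ< (suc m) (λ k → C k * x (k + l))
  Σ<-reflect m l C x = trans (Σ<-reverse (suc m) (λ i → C (m ∸ i) * x (m + l ∸ i)))
    (Σ<-cong (suc m) (λ k k≤m → cong₂ (λ i j → C i * x j) (ℕₚ.m∸[m∸n]≡n (ℕₚ.≤-pred k≤m))
       (trans (ℕₚ.+-∸-comm l (ℕₚ.m∸n≤m m k)) (cong (_+ l) (ℕₚ.m∸[m∸n]≡n (ℕₚ.≤-pred k≤m))))))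

  dependentRows⇒PadeCondition : ∀ m n x → LinearlyDependent F (hankel m n x) → PadeCondition m m (suc (m + n)) x
  dependentRows⇒PadeCondition m n x (w , (i₀ , wᵢ₀≢0) , wH≡0) = C , deg , nz , C⋆x≡0
    where
    C : Series
    C k = when (k ≤? m) (fromVector w (m ∸ k))
    deg : DegreeAtMost m C
    deg i m<i = when-no (i ≤? m) _ (ℕₚ.<⇒≱ m<i)
    i₀≤m : toℕ i₀ ≤ m
    i₀≤m = ℕₚ.≤-pred (Finₚ.toℕ<n i₀)
    nz : NonzeroUpTo m C
    nz = m ∸ toℕ i₀ , ℕₚ.m∸n≤m m (toℕ i₀) , λ C≡0 → wᵢ₀≢0 (begin
      w i₀                             ≡⟨ sym (fromVector-toℕ w i₀) ⟩
      fromVector w (toℕ i₀)            ≡⟨ cong (fromVector w) (sym (ℕₚ.m∸[m∸n]≡n i₀≤m)) ⟩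
      fromVector w (m ∸ (m ∸ toℕ i₀))  ≡⟨ sym (when-yes ((m ∸ toℕ i₀) ≤? m) _ (ℕₚ.m∸n≤m m (toℕ i₀))) ⟩
      C (m ∸ toℕ i₀)                   ≡⟨ C≡0 ⟩
      0#                               ∎)
    C⋆x≡0 : ∀ s → m ≤ s → s < suc (m + n) → (C ⋆ x) s ≡ 0#
    C⋆x≡0 s m≤s s<N = begin
      (C ⋆ x) s                                              ≡⟨ ⋆-truncate x s deg m≤s ⟩
      Σ< (suc m) (λ i → C i * x (s ∸ i))
        ≡⟨ Σ<-cong (suc m) (λ i i≤m → cong₂ _*_ (when-yes (i ≤? m) (fromVector w (m ∸ i)) (ℕₚ.≤-pred i≤m)) (cong (λ k → x (k ∸ i)) (sym m+l≡s))) ⟩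
      Σ< (suc m) (λ i → fromVector w (m ∸ i) * x (m + l ∸ i)) ≡⟨ Σ<-reflect m l (fromVector w) x ⟩
      Σ< (suc m) (λ k → fromVector w k * x (k + l))          ≡⟨ sym (∑≡Σ< (suc m) (λ k → fromVector w k * x (k + l))) ⟩
      ∑ F {suc m} (λ i → fromVector w (toℕ i) * x (toℕ i + l))
        ≡⟨ ∑-cong entry ⟩
      ∑ F (λ i → w i * hankel m n x i (fromℕ< l<n))          ≡⟨ wH≡0 (fromℕ< l<n) ⟩
      0#                                                     ∎
      where
      l = s ∸ m
      m+l≡s : m + l ≡ s
      m+l≡s = ℕₚ.m+[n∸m]≡n m≤s
      l<n : l < suc n
      l<n = ℕₚ.+-cancelˡ-< m l (suc n) (subst (_< m + suc n) (sym m+l≡s) (subst (s <_) (sym (ℕₚ.+-suc m n)) s<N))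
      entry : ∀ i → fromVector w (toℕ i) * x (toℕ i + l) ≡ w i * hankel m n x i (fromℕ< l<n)
      entry i = cong₂ (λ a b → a * x (toℕ i + b)) (fromVector-toℕ w i) (sym (Finₚ.toℕ-fromℕ< l<n))

  PadeCondition⇒dependentRows : ∀ m n x → PadeCondition m m (suc (m + n)) x → LinearlyDependent F (hankel m n x)
  PadeCondition⇒dependentRows m n x (C , deg , (i₀ , i₀≤m , Cᵢ₀≢0) , C⋆x≡0) = w , (k₀ , wₖ₀≢0) , wH≡0
    where
    w : Fin (suc m) → Carrier
    w i = C (m ∸ toℕ i)
    k₀ : Fin (suc m)
    k₀ = fromℕ< (s≤s (ℕₚ.m∸n≤m m i₀))
    wₖ₀≢0 : w k₀ ≢ 0#
    wₖ₀≢0 w≡0 = Cᵢ₀≢0 (begin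
      C i₀                  ≡⟨ cong C (sym (ℕₚ.m∸[m∸n]≡n i₀≤m)) ⟩
      C (m ∸ (m ∸ i₀))      ≡⟨ cong (λ k → C (m ∸ k)) (sym (Finₚ.toℕ-fromℕ< (s≤s (ℕₚ.m∸n≤m m i₀)))) ⟩
      w k₀                  ≡⟨ w≡0 ⟩
      0#                    ∎)
    wH≡0 : ∀ j → ∑ F (λ i → w i * hankel m n x i j) ≡ 0#
    wH≡0 j = begin
      ∑ F {suc m} (λ i → C (m ∸ toℕ i) * x (toℕ i + l))  ≡⟨ ∑≡Σ< (suc m) (λ k → C (m ∸ k) * x (k + l)) ⟩
      Σ< (suc m) (λ k → C (m ∸ k) * x (k + l))           ≡⟨ sym (Σ<-reflect m l (λ k → C (m ∸ k)) x) ⟩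
      Σ< (suc m) (λ i → C (m ∸ (m ∸ i)) * x (m + l ∸ i))
        ≡⟨ Σ<-cong (suc m) (λ i i≤m → cong (λ k → C k * x (m + l ∸ i)) (ℕₚ.m∸[m∸n]≡n (ℕₚ.≤-pred i≤m))) ⟩
      Σ< (suc m) (λ i → C i * x (m + l ∸ i))             ≡⟨ sym (⋆-truncate x (m + l) deg (ℕₚ.m≤m+n m l)) ⟩
      (C ⋆ x) (m + l)                                    ≡⟨ C⋆x≡0 (m + l) (ℕₚ.m≤m+n m l) (s≤s (ℕₚ.+-monoʳ-≤ m (ℕₚ.≤-pred (Finₚ.toℕ<n j)))) ⟩
      0#                                                 ∎
      where
      l = toℕ j

module Cardinality where
  open Nat using (_+_; _*_; _^_)

  HasCardinality-cong : ∀ {a p q} {A : Set a} {P : A → Set p} {Q : A → Set q} {N} →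
                        (∀ x → P x ⇔ Q x) → HasCardinality P N → HasCardinality Q N
  HasCardinality-cong P⇔Q (xs , unique , xs↔P , length≡N) = xs , unique , (λ x → ⇔-trans (xs↔P x) (P⇔Q x)) , length≡N

  Unique-map-injectiveOn : ∀ {a b} {A : Set a} {B : Set b} (φ : A → B) {xs : List A} →
                           (∀ {x y} → x ∈ xs → y ∈ xs → φ x ≡ φ y → x ≡ y) → Unique xs → Unique (map φ xs)
  Unique-map-injectiveOn φ {[]}     _         []               = []
  Unique-map-injectiveOn φ {x ∷ xs} injective (x∉xs ∷ unique) =
    AllP.map⁺ (All.tabulate (λ y∈xs φx≡φy → All.lookup x∉xs y∈xs (injective (here refl) (there y∈xs) φx≡φy)))
    ∷ Unique-map-injectiveOn φ (λ x∈ y∈ → injective (there x∈) (there y∈)) unique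

  HasCardinality-bijection : ∀ {a b p q} {A : Set a} {B : Set b} {P : A → Set p} {Q : B → Set q} {N}
    (φ : A → B) (ψ : B → A) → (∀ x → P x → Q (φ x)) → (∀ y → Q y → P (ψ y)) →
    (∀ x → P x → ψ (φ x) ≡ x) → (∀ y → Q y → φ (ψ y) ≡ y) → HasCardinality P N → HasCardinality Q N
  HasCardinality-bijection {P = P} {Q} φ ψ P⇒Qφ Q⇒Pψ ψφ φψ (xs , unique , xs↔P , length≡N) =
    map φ xs , Unique-map-injectiveOn φ injective unique , φxs↔Q , trans (ListP.length-map φ xs) length≡N
    where
    P-member : ∀ {x} → x ∈ xs → P x
    P-member = Equivalence.to (xs↔P _)
    injective : ∀ {x y} → x ∈ xs → y ∈ xs → φ x ≡ φ y → x ≡ y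
    injective {x} {y} x∈ y∈ φx≡φy = trans (sym (ψφ x (P-member x∈))) (trans (cong ψ φx≡φy) (ψφ y (P-member y∈)))
    from-map : ∀ y → y ∈ map φ xs → Q y
    from-map y y∈ with MemP.∈-map⁻ φ y∈
    ... | x , x∈ , refl = P⇒Qφ x (P-member x∈)
    to-map : ∀ y → Q y → y ∈ map φ xs
    to-map y Qy = subst (_∈ map φ xs) (φψ y Qy) (MemP.∈-map⁺ φ (Equivalence.from (xs↔P (ψ y)) (Q⇒Pψ y Qy)))
    φxs↔Q : ∀ y → (y ∈ map φ xs) ⇔ Q y
    φxs↔Q y = mk⇔ (from-map y) (to-map y)

  module ListsOver {a} {A : Set a} (alphabet : List A) (alphabet-unique : Unique alphabet)
                   (alphabet-complete : ∀ e → e ∈ alphabet) where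
    q : ℕ
    q = length alphabet

    module _ {p} {L N : ℕ} (P : List A → Set p)
             (count-tails : ∀ e → HasCardinality (λ ys → length ys ≡ L × P (e ∷ ys)) N) where
      private
        tails : A → List (List A)
        tails e = proj₁ (count-tails e)

        ∈-tails : ∀ e ys → ys ∈ tails e ⇔ (length ys ≡ L × P (e ∷ ys))
        ∈-tails e ys = proj₁ (proj₂ (proj₂ (count-tails e))) ys

        withHeads : List A → List (List A)
        withHeads []          = []
        withHeads (e ∷ heads) = map (e ∷_) (tails e) ++ withHeads heads

        ∈-withHeads⁻ : ∀ heads ys → ys ∈ withHeads heads →
                       Σ A λ e → e ∈ heads × Σ (List A) λ ys′ → ys ≡ e ∷ ys′ × (length ys′ ≡ L × P (e ∷ ys′))
        ∈-withHeads⁻ (e ∷ heads) ys ys∈ with MemP.∈-++⁻ (map (e ∷_) (tails e)) ys∈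
        ... | inj₁ ys∈e∷tails with MemP.∈-map⁻ (e ∷_) ys∈e∷tails
        ...   | ys′ , ys′∈ , refl = e , here refl , ys′ , refl , Equivalence.to (∈-tails e ys′) ys′∈
        ∈-withHeads⁻ (e ∷ heads) ys ys∈ | inj₂ ys∈rest with ∈-withHeads⁻ heads ys ys∈rest
        ... | e′ , e′∈ , ys′ , ys≡ , Pys′ = e′ , there e′∈ , ys′ , ys≡ , Pys′

        ∈-withHeads⁺ : ∀ heads e ys′ → e ∈ heads → (length ys′ ≡ L × P (e ∷ ys′)) → (e ∷ ys′) ∈ withHeads heads
        ∈-withHeads⁺ (e ∷ heads) .e ys′ (here refl) Pys′ =
          MemP.∈-++⁺ˡ (MemP.∈-map⁺ (e ∷_) (Equivalence.from (∈-tails e ys′) Pys′))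
        ∈-withHeads⁺ (e₁ ∷ heads) e ys′ (there e∈) Pys′ = MemP.∈-++⁺ʳ (map (e₁ ∷_) (tails e₁)) (∈-withHeads⁺ heads e ys′ e∈ Pys′)

        withHeads-unique : ∀ heads → Unique heads → Unique (withHeads heads)
        withHeads-unique []          _                = []
        withHeads-unique (e ∷ heads) (e∉heads ∷ unique) =
          UniqueP.++⁺ (UniqueP.map⁺ ListP.∷-injectiveʳ (proj₁ (proj₂ (count-tails e)))) (withHeads-unique heads unique) disjoint
          where
          disjoint : ∀ {v} → ¬ (v ∈ map (e ∷_) (tails e) × v ∈ withHeads heads)
          disjoint (v∈here , v∈rest) with MemP.∈-map⁻ (e ∷_) v∈here | ∈-withHeads⁻ heads _ v∈rest
          ... | _ , _ , refl | e′ , e′∈ , _ , v≡ , _ = All.lookup e∉heads e′∈ (ListP.∷-injectiveˡ v≡)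

        length-withHeads : ∀ heads → length (withHeads heads) ≡ length heads * N
        length-withHeads []          = refl
        length-withHeads (e ∷ heads) = trans (ListP.length-++ (map (e ∷_) (tails e)))
          (cong₂ _+_ (trans (ListP.length-map (e ∷_) (tails e)) (proj₂ (proj₂ (proj₂ (count-tails e)))))
                     (length-withHeads heads))

      count-by-head : HasCardinality (λ ys → length ys ≡ suc L × P ys) (q * N)
      count-by-head = withHeads alphabet , withHeads-unique alphabet alphabet-unique , (λ ys → mk⇔ (sound ys) (complete ys)) ,
                      length-withHeads alphabet
        where
        sound : ∀ ys → ys ∈ withHeads alphabet → length ys ≡ suc L × P ys
        sound ys ys∈ with ∈-withHeads⁻ alphabet ys ys∈
        ... | e , _ , ys′ , refl , (length≡L , Pys) = cong suc length≡L , Pys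
        complete : ∀ ys → length ys ≡ suc L × P ys → ys ∈ withHeads alphabet
        complete (e ∷ ys′) (length≡ , Pys) = ∈-withHeads⁺ alphabet e ys′ (alphabet-complete e) (ℕₚ.suc-injective length≡ , Pys)

    count-all : ∀ L → HasCardinality (λ (ys : List A) → length ys ≡ L × ⊤) (q ^ L)
    count-all zero    = [] ∷ [] , All.[] ∷ [] , (λ ys → mk⇔ (sound ys) (complete ys)) , refl
      where
      sound : ∀ ys → ys ∈ [] ∷ [] → length ys ≡ 0 × ⊤
      sound .[] (here refl) = refl , tt
      complete : ∀ ys → length ys ≡ 0 × ⊤ → ys ∈ [] ∷ []
      complete [] _ = here refl
    count-all (suc L) = count-by-head (λ _ → ⊤) (λ _ → count-all L)

    count-after-drop : ∀ d {p} {L N} (P : List A → Set p) → HasCardinality (λ zs → length zs ≡ L × P zs) N →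
                       HasCardinality (λ ys → length ys ≡ d + L × P (drop d ys)) (q ^ d * N)
    count-after-drop zero    {N = N} P count = subst (HasCardinality _) (sym (ℕₚ.+-identityʳ N)) count
    count-after-drop (suc d) {N = N} P count =
      subst (HasCardinality _) (sym (ℕₚ.*-assoc q (q ^ d) N))
        (count-by-head (λ ys → P (drop (suc d) ys)) (λ e → count-after-drop d P count))

module _ {a} {A : Set a} where
  open Nat using (_∸_; _≤_)

  drop-++-≤ : ∀ d (xs ys : List A) → d ≤ length xs → drop d (xs ++ ys) ≡ drop d xs ++ ys
  drop-++-≤ zero    xs       ys _        = refl
  drop-++-≤ (suc d) (x ∷ xs) ys (s≤s d≤) = drop-++-≤ d xs ys d≤

  drop-++-≥ : ∀ d (xs ys : List A) → length xs ≤ d → drop d (xs ++ ys) ≡ drop (d ∸ length xs) ys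
  drop-++-≥ d       []       ys _        = refl
  drop-++-≥ (suc d) (x ∷ xs) ys (s≤s ≤d) = drop-++-≥ d xs ys ≤d

module ListSeries {c : Level} (F : Field c) (_≟_ : DecidableEquality (Field.Carrier F)) where
  open FieldProperties F renaming (_+_ to _⊹_)
  open PowerSeries F
  open Nat using (_+_; _<_)

  toSeries : List Carrier → Series
  toSeries []       _       = 0#
  toSeries (x ∷ xs) zero    = x
  toSeries (x ∷ xs) (suc k) = toSeries xs k

  takeCoeffs : ℕ → Series → List Carrier
  takeCoeffs zero    g = []
  takeCoeffs (suc n) g = g 0 ∷ takeCoeffs n (λ i → g (suc i))

  length-takeCoeffs : ∀ n g → length (takeCoeffs n g) ≡ n
  length-takeCoeffs zero    g = refl
  length-takeCoeffs (suc n) g = cong suc (length-takeCoeffs n (λ i → g (suc i)))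

  toSeries-takeCoeffs : ∀ n g → AgreeBelow n (toSeries (takeCoeffs n g)) g
  toSeries-takeCoeffs (suc n) g zero    _         = refl
  toSeries-takeCoeffs (suc n) g (suc i) (s≤s i<n) = toSeries-takeCoeffs n (λ i → g (suc i)) i i<n

  takeCoeffs-cong : ∀ n {g h} → AgreeBelow n g h → takeCoeffs n g ≡ takeCoeffs n h
  takeCoeffs-cong zero    g≈h = refl
  takeCoeffs-cong (suc n) g≈h = cong₂ _∷_ (g≈h 0 (s≤s z≤n)) (takeCoeffs-cong n (λ i i<n → g≈h (suc i) (s≤s i<n)))

  takeCoeffs-+ : ∀ l L g → takeCoeffs (l + L) g ≡ takeCoeffs l g ++ takeCoeffs L (λ i → g (l + i))
  takeCoeffs-+ zero    L g = refl
  takeCoeffs-+ (suc l) L g = cong (g 0 ∷_) (takeCoeffs-+ l L (λ i → g (suc i)))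

  toSeries-++ˡ : ∀ xs ys → AgreeBelow (length xs) (toSeries (xs ++ ys)) (toSeries xs)
  toSeries-++ˡ (x ∷ xs) ys zero    _         = refl
  toSeries-++ˡ (x ∷ xs) ys (suc i) (s≤s i<n) = toSeries-++ˡ xs ys i i<n

  toSeries-++ʳ : ∀ xs ys i → toSeries (xs ++ ys) (length xs + i) ≡ toSeries ys i
  toSeries-++ʳ []       ys i = refl
  toSeries-++ʳ (x ∷ xs) ys i = toSeries-++ʳ xs ys i

  toSeries-drop : ∀ d xs i → toSeries (drop d xs) i ≡ toSeries xs (d + i)
  toSeries-drop zero    xs       i = refl
  toSeries-drop (suc d) []       i = refl
  toSeries-drop (suc d) (x ∷ xs) i = toSeries-drop d xs i

  toSeries-zeros : ∀ j i → toSeries (replicate j 0#) i ≡ 0#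
  toSeries-zeros zero    i       = refl
  toSeries-zeros (suc j) zero    = refl
  toSeries-zeros (suc j) (suc i) = toSeries-zeros j i

  toSeries-injective : ∀ xs ys → length xs ≡ length ys → AgreeBelow (length xs) (toSeries xs) (toSeries ys) → xs ≡ ys
  toSeries-injective []       []       _       _     = refl
  toSeries-injective (x ∷ xs) (y ∷ ys) length≡ xs≈ys =
    cong₂ _∷_ (xs≈ys 0 (s≤s z≤n)) (toSeries-injective xs ys (ℕₚ.suc-injective length≡) (λ i i<n → xs≈ys (suc i) (s≤s i<n)))

  takeCoeffs-toSeries : ∀ ys → takeCoeffs (length ys) (toSeries ys) ≡ ys
  takeCoeffs-toSeries ys = toSeries-injective _ ys (length-takeCoeffs (length ys) (toSeries ys))
    (λ i i<n → toSeries-takeCoeffs (length ys) (toSeries ys) i (subst (i <_) (length-takeCoeffs (length ys) (toSeries ys)) i<n))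

  leading-zeros : ∀ (a : List Carrier) → (a ≡ replicate (length a) 0#) ⊎
    Σ ℕ λ j → Σ Carrier λ aⱼ → Σ (List Carrier) λ a′ → aⱼ ≢ 0# × a ≡ replicate j 0# ++ aⱼ ∷ a′
  leading-zeros []      = inj₁ refl
  leading-zeros (x ∷ a) with x ≟ 0#
  ... | no x≢0 = inj₂ (0 , x , a , x≢0 , refl)
  ... | yes refl with leading-zeros a
  ...   | inj₁ a≡0                     = inj₁ (cong (0# ∷_) a≡0)
  ...   | inj₂ (j , aⱼ , a′ , aⱼ≢0 , a≡) = inj₂ (suc j , aⱼ , a′ , aⱼ≢0 , cong (0# ∷_) a≡)

module ReciprocalLists {c : Level} (F : Field c) (_≟_ : DecidableEquality (Field.Carrier F)) where
  open FieldProperties F renaming (_+_ to _⊹_)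
  open PowerSeries F
  open ListSeries F _≟_
  open Nat using (_+_; _<_)
  open ≡-Reasoning

  reciprocal-involutive : ∀ N w w₀≢0 v v₀≢0 → AgreeBelow N v (reciprocal w w₀≢0) → AgreeBelow N (reciprocal v v₀≢0) w
  reciprocal-involutive N w w₀≢0 v v₀≢0 v≈1/w = reciprocal-unique {N} {v} {reciprocal w w₀≢0} {reciprocal v v₀≢0} {w}
    (λ i _ → ⋆-reciprocalʳ v v₀≢0 i) (λ i _ → ⋆-reciprocalˡ w w₀≢0 i) v≈1/w

  reciprocalPrefix : ∀ p₀ p′ → p₀ ≢ 0# → List Carrier
  reciprocalPrefix p₀ p′ p₀≢0 = takeCoeffs (suc (length p′)) (reciprocal (toSeries (p₀ ∷ p′)) p₀≢0)

  reciprocalTail : ∀ p₀ p′ → p₀ ≢ 0# → ℕ → List Carrier → List Carrier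
  reciprocalTail p₀ p′ p₀≢0 L ys = takeCoeffs L (λ i → reciprocal (toSeries (p₀ ∷ p′ ++ ys)) p₀≢0 (suc (length p′) + i))

  length-reciprocalTail : ∀ p₀ p′ p₀≢0 L ys → length (reciprocalTail p₀ p′ p₀≢0 L ys) ≡ L
  length-reciprocalTail p₀ p′ p₀≢0 L ys = length-takeCoeffs L _

  reciprocal-++ : ∀ p₀ p′ p₀≢0 L ys →
    takeCoeffs (suc (length p′) + L) (reciprocal (toSeries (p₀ ∷ p′ ++ ys)) p₀≢0) ≡
    reciprocalPrefix p₀ p′ p₀≢0 ++ reciprocalTail p₀ p′ p₀≢0 L ys
  reciprocal-++ p₀ p′ p₀≢0 L ys =
    trans (takeCoeffs-+ (suc (length p′)) L (reciprocal w p₀≢0))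
          (cong (_++ reciprocalTail p₀ p′ p₀≢0 L ys) (takeCoeffs-cong (suc (length p′))
            (reciprocal-unique {suc (length p′)} {w} {toSeries (p₀ ∷ p′)} {reciprocal w p₀≢0}
              (λ i _ → ⋆-reciprocalʳ w p₀≢0 i) (λ i _ → ⋆-reciprocalʳ (toSeries (p₀ ∷ p′)) p₀≢0 i)
              (toSeries-++ˡ (p₀ ∷ p′) ys))))
    where
    w = toSeries (p₀ ∷ p′ ++ ys)

  length-reciprocalPrefix : ∀ p₀ p′ p₀≢0 {b₀ b′} → b₀ ∷ b′ ≡ reciprocalPrefix p₀ p′ p₀≢0 → length b′ ≡ length p′
  length-reciprocalPrefix p₀ p′ p₀≢0 b≡ =
    ℕₚ.suc-injective (trans (cong length b≡) (length-takeCoeffs (suc (length p′)) (reciprocal (toSeries (p₀ ∷ p′)) p₀≢0)))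

  reciprocalPrefix-involutive : ∀ p₀ p′ p₀≢0 b₀ b′ b₀≢0 → b₀ ∷ b′ ≡ reciprocalPrefix p₀ p′ p₀≢0 →
                                reciprocalPrefix b₀ b′ b₀≢0 ≡ p₀ ∷ p′
  reciprocalPrefix-involutive p₀ p′ p₀≢0 b₀ b′ b₀≢0 b≡ = toSeries-injective _ (p₀ ∷ p′) length≡ agree
    where
    n = suc (length b′)
    1/b = reciprocal (toSeries (b₀ ∷ b′)) b₀≢0
    length≡ : length (reciprocalPrefix b₀ b′ b₀≢0) ≡ suc (length p′)
    length≡ = trans (length-takeCoeffs n 1/b) (cong suc (length-reciprocalPrefix p₀ p′ p₀≢0 b≡))
    b≈1/p : AgreeBelow (suc (length p′)) (toSeries (b₀ ∷ b′)) (reciprocal (toSeries (p₀ ∷ p′)) p₀≢0)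
    b≈1/p i i<n = trans (cong (λ xs → toSeries xs i) b≡) (toSeries-takeCoeffs _ (reciprocal (toSeries (p₀ ∷ p′)) p₀≢0) i i<n)
    agree : AgreeBelow (length (reciprocalPrefix b₀ b′ b₀≢0)) (toSeries (reciprocalPrefix b₀ b′ b₀≢0)) (toSeries (p₀ ∷ p′))
    agree i i<n = trans (toSeries-takeCoeffs n 1/b i (subst (i <_) (length-takeCoeffs n 1/b) i<n))
      (reciprocal-involutive (suc (length p′)) (toSeries (p₀ ∷ p′)) p₀≢0 (toSeries (b₀ ∷ b′)) b₀≢0 b≈1/p i
        (subst (i <_) length≡ i<n))

  reciprocalTail-involutive : ∀ p₀ p′ p₀≢0 b₀ b′ b₀≢0 L ys → b₀ ∷ b′ ≡ reciprocalPrefix p₀ p′ p₀≢0 → length ys ≡ L →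
                              reciprocalTail b₀ b′ b₀≢0 L (reciprocalTail p₀ p′ p₀≢0 L ys) ≡ ys
  reciprocalTail-involutive p₀ p′ p₀≢0 b₀ b′ b₀≢0 L ys b≡ length-ys = begin
    reciprocalTail b₀ b′ b₀≢0 L zs
      ≡⟨ takeCoeffs-cong L (λ i i<L → trans (cong (λ k → reciprocal v b₀≢0 (suc k + i)) (length-reciprocalPrefix p₀ p′ p₀≢0 b≡))
           (reciprocal-involutive N w p₀≢0 v b₀≢0 v≈1/w (suc (length p′) + i) (ℕₚ.+-monoʳ-< (suc (length p′)) i<L))) ⟩
    takeCoeffs L (λ i → w (suc (length p′) + i))  ≡⟨ takeCoeffs-cong L (λ i _ → toSeries-++ʳ (p₀ ∷ p′) ys i) ⟩
    takeCoeffs L (toSeries ys)                    ≡⟨ subst (λ L → takeCoeffs L (toSeries ys) ≡ ys) length-ys (takeCoeffs-toSeries ys) ⟩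
    ys                                            ∎
    where
    N = suc (length p′) + L
    w = toSeries (p₀ ∷ p′ ++ ys)
    zs = reciprocalTail p₀ p′ p₀≢0 L ys
    v = toSeries (b₀ ∷ b′ ++ zs)
    b++zs≡ : b₀ ∷ b′ ++ zs ≡ takeCoeffs N (reciprocal w p₀≢0)
    b++zs≡ = trans (cong (_++ zs) b≡) (sym (reciprocal-++ p₀ p′ p₀≢0 L ys))
    v≈1/w : AgreeBelow N v (reciprocal w p₀≢0)
    v≈1/w i i<N = trans (cong (λ xs → toSeries xs i) b++zs≡) (toSeries-takeCoeffs N (reciprocal w p₀≢0) i i<N)

module LowRankRecursion {c : Level} (F : Field c) (_≟_ : DecidableEquality (Field.Carrier F)) where
  open FieldProperties F renaming (_+_ to _⊹_)
  open PowerSeries F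
  open PadeConditions F _≟_
  open ListSeries F _≟_
  open Nat using (_+_; _∸_; _<_; _≤_)
  open Related.EquationalReasoning {k = Related.equivalence}
  open +-*-Solver using (solve; _:=_; con; _:+_)

  LowRank : ℕ → ℕ → List Carrier → Set c
  LowRank m n xs = PadeCondition m m (suc (m + n)) (toSeries xs)

  toSeries-zeros++ : ∀ j xs i → toSeries (replicate j 0# ++ xs) i ≡ shiftBy j (toSeries xs) i
  toSeries-zeros++ zero    xs i       = refl
  toSeries-zeros++ (suc j) xs zero    = refl
  toSeries-zeros++ (suc j) xs (suc i) = toSeries-zeros++ j xs i

  LowRank-zeros++⇔ : ∀ m n ys → LowRank m n (replicate m 0# ++ ys) ⇔ (∀ i → i < suc n ∸ m → toSeries ys i ≡ 0#)
  LowRank-zeros++⇔ m n ys = begin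
    LowRank m n (replicate m 0# ++ ys)                    ∼⟨ PadeCondition-cong (λ i _ → toSeries-zeros++ m ys i) ⟩
    PadeCondition m m (suc (m + n)) (shiftBy m (toSeries ys))
      ≡⟨ cong₂ (λ R N → PadeCondition m R N (shiftBy m (toSeries ys))) (sym (ℕₚ.+-identityʳ m)) (sym (ℕₚ.+-suc m n)) ⟩
    PadeCondition m (m + 0) (m + suc n) (shiftBy m (toSeries ys)) ∼⟨ PadeCondition-shiftBy m ⟩
    PadeCondition m 0 (suc n) (toSeries ys)                ∼⟨ PadeCondition₀⇔vanishing m n (toSeries ys) ⟩
    (∀ i → i < suc n ∸ m → toSeries ys i ≡ 0#)             ∎

  -- With x = zʲ h and h(0) ≠ 0, a Padé form for x is one for h, and dually one for 1/h with the roles of degree and window swapped.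
  LowRank-reciprocal⇔ : ∀ j m′ n′ aⱼ a′ (aⱼ≢0 : aⱼ ≢ 0#) ys →
    let h = toSeries (aⱼ ∷ a′ ++ ys)
        T = takeCoeffs (suc m′ + suc (j + suc n′)) (reciprocal h aⱼ≢0)
    in LowRank (j + suc m′) (j + suc n′) (replicate j 0# ++ aⱼ ∷ a′ ++ ys) ⇔ LowRank m′ n′ (drop (2 + j) T)
  LowRank-reciprocal⇔ j m′ n′ aⱼ a′ aⱼ≢0 ys = begin
    LowRank m n (replicate j 0# ++ aⱼ ∷ a′ ++ ys)          ∼⟨ PadeCondition-cong (λ i _ → toSeries-zeros++ j (aⱼ ∷ a′ ++ ys) i) ⟩
    PadeCondition m m (suc (m + n)) (shiftBy j h)         ≡⟨ cong (λ N → PadeCondition m m N (shiftBy j h)) window-x ⟩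
    PadeCondition m (j + suc m′) (j + N′) (shiftBy j h)   ∼⟨ PadeCondition-shiftBy j ⟩
    PadeCondition m (suc m′) N′ h                         ∼⟨ PadeCondition-reciprocal⇔ (λ i _ → ⋆-reciprocalʳ h aⱼ≢0 i) m<N′ m′<N′ ⟩
    PadeCondition m′ (suc m) N′ g                         ∼⟨ PadeCondition-cong (λ i i<N′ → sym (toSeries-takeCoeffs N′ g i i<N′)) ⟩
    PadeCondition m′ (suc m) N′ (toSeries T)
      ≡⟨ cong₂ (λ R N → PadeCondition m′ R N (toSeries T)) degree-g window-g ⟩
    PadeCondition m′ (d + m′) (d + suc (m′ + n′)) (toSeries T) ∼⟨ PadeCondition-dropCoeffs d ℕₚ.≤-refl ⟩
    PadeCondition m′ m′ (suc (m′ + n′)) (dropCoeffs d (toSeries T)) ∼⟨ PadeCondition-cong (λ i _ → sym (toSeries-drop d T i)) ⟩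
    LowRank m′ n′ (drop d T)                              ∎
    where
    m = j + suc m′
    n = j + suc n′
    d = 2 + j
    N′ = suc m′ + suc n
    h = toSeries (aⱼ ∷ a′ ++ ys)
    g = reciprocal h aⱼ≢0
    T = takeCoeffs N′ g
    window-x : suc (m + n) ≡ j + N′
    window-x = solve 3 (λ j m′ n′ → con 1 :+ ((j :+ (con 1 :+ m′)) :+ (j :+ (con 1 :+ n′)))
                                  := j :+ ((con 1 :+ m′) :+ (con 1 :+ (j :+ (con 1 :+ n′))))) refl j m′ n′
    degree-g : suc m ≡ d + m′
    degree-g = cong suc (ℕₚ.+-suc j m′)
    window-g : N′ ≡ d + suc (m′ + n′)
    window-g = solve 3 (λ j m′ n′ → (con 1 :+ m′) :+ (con 1 :+ (j :+ (con 1 :+ n′)))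
                                  := (con 2 :+ j) :+ (con 1 :+ (m′ :+ n′))) refl j m′ n′
    m<N′ : m < N′
    m<N′ = subst (m <_) (solve 3 (λ j m′ n′ → (con 1 :+ (j :+ (con 1 :+ m′))) :+ (con 1 :+ n′)
                                             := (con 1 :+ m′) :+ (con 1 :+ (j :+ (con 1 :+ n′)))) refl j m′ n′)
                 (ℕₚ.m≤m+n (suc m) (suc n′))
    m′<N′ : m′ < N′
    m′<N′ = s≤s (ℕₚ.m≤m+n m′ (suc n))

module HankelCounting {c : Level} (F : Field c) (_≟_ : DecidableEquality (Field.Carrier F))
                      (alphabet : List (Field.Carrier F)) (alphabet-unique : Unique alphabet)
                      (alphabet-complete : ∀ e → e ∈ alphabet) where
  open Field F using (Carrier; 0#)
  open PowerSeries F
  open ListSeries F _≟_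
  open ReciprocalLists F _≟_
  open LowRankRecursion F _≟_
  open Cardinality
  open ListsOver alphabet alphabet-unique alphabet-complete
  open Nat using (_+_; _*_; _^_; _∸_; _<_; _≤_; _≤?_)

  count-zeros++ : ∀ l L → HasCardinality (λ ys → length ys ≡ l + L × (∀ i → i < l → toSeries ys i ≡ 0#)) (q ^ L)
  count-zeros++ l L = HasCardinality-bijection (replicate l 0# ++_) (drop l) to from
    (λ zs _ → drop-zeros++ l zs)
    (λ ys (length≡ , zeros) → zeros++drop ys (subst (l ≤_) (sym length≡) (ℕₚ.m≤m+n l L)) zeros) (count-all L)
    where
    drop-zeros++ : ∀ l zs → drop l (replicate l 0# ++ zs) ≡ zs
    drop-zeros++ zero    zs = refl
    drop-zeros++ (suc l) zs = drop-zeros++ l zs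
    zeros++drop : ∀ {l} ys → l ≤ length ys → (∀ i → i < l → toSeries ys i ≡ 0#) → replicate l 0# ++ drop l ys ≡ ys
    zeros++drop {zero}  ys       _         _     = refl
    zeros++drop {suc l} (y ∷ ys) (s≤s l≤) zeros =
      cong₂ _∷_ (sym (zeros 0 (s≤s z≤n))) (zeros++drop ys l≤ (λ i i<l → zeros (suc i) (s≤s i<l)))
    to : ∀ zs → length zs ≡ L × ⊤ → length (replicate l 0# ++ zs) ≡ l + L × (∀ i → i < l → toSeries (replicate l 0# ++ zs) i ≡ 0#)
    to zs (length≡L , _) = trans (ListP.length-++ (replicate l 0#)) (cong₂ _+_ (ListP.length-replicate l) length≡L) ,
      λ i i<l → trans (toSeries-++ˡ (replicate l 0#) zs i (subst (i <_) (sym (ListP.length-replicate l)) i<l)) (toSeries-zeros l i)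
    from : ∀ ys → length ys ≡ l + L × (∀ i → i < l → toSeries ys i ≡ 0#) → length (drop l ys) ≡ L × ⊤
    from ys (length≡ , _) = trans (ListP.length-drop l ys) (trans (cong (_∸ l) length≡) (ℕₚ.m+n∸m≡n l L)) , tt

  ExtensionCount : ℕ → ℕ → List Carrier → Set c
  ExtensionCount m n a = HasCardinality (λ ys → length ys ≡ suc n × LowRank m n (a ++ ys)) (q ^ m)

  FullPrefixCount : ℕ → Set c
  FullPrefixCount m = ∀ n → m ≤ n → ∀ a → length a ≡ m → ExtensionCount m n a

  PrefixCount : ℕ → Set c
  PrefixCount m = ∀ n → m ≤ n → ∀ e k → k + e ≡ m → ∀ a → length a ≡ k →
    HasCardinality (λ ys → length ys ≡ e + suc n × LowRank m n (a ++ ys)) (q ^ (e + m))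

  ExtensionCount-≡ : ∀ {m m₁ n n₁ a a₁} → m₁ ≡ m → n₁ ≡ n → a₁ ≡ a → ExtensionCount m₁ n₁ a₁ → ExtensionCount m n a
  ExtensionCount-≡ refl refl refl count = count

  count-zero-prefix : ∀ m n → m ≤ n → ExtensionCount m n (replicate m 0#)
  count-zero-prefix m n m≤n =
    subst (λ L → HasCardinality (λ ys → length ys ≡ L × LowRank m n (replicate m 0# ++ ys)) (q ^ m))
          (ℕₚ.m∸n+n≡m (ℕₚ.m≤n⇒m≤1+n m≤n))
          (HasCardinality-cong (λ ys → ⇔-refl ×-⇔ ⇔-sym (LowRank-zeros++⇔ m n ys)) (count-zeros++ (suc n ∸ m) m))

  count-short-prefix : ∀ m → FullPrefixCount m → PrefixCount m
  count-short-prefix m count-full n m≤n zero    k k+0≡m a length≡k =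
    count-full n m≤n a (trans length≡k (trans (sym (ℕₚ.+-identityʳ k)) k+0≡m))
  count-short-prefix m count-full n m≤n (suc e) k k+e≡m a length≡k = count-by-head (λ ys → LowRank m n (a ++ ys)) λ y →
    HasCardinality-cong (λ ys → ⇔-refl ×-⇔ Related.≡⇒ (cong (LowRank m n) (ListP.++-assoc a (y ∷ []) ys)))
      (count-short-prefix m count-full n m≤n e (suc k) (trans (sym (ℕₚ.+-suc k e)) k+e≡m) (a ++ y ∷ [])
        (trans (ListP.length-++ a) (trans (cong (_+ 1) length≡k) (ℕₚ.+-comm k 1))))

  module FullPrefixStep (j n′ : ℕ) (aⱼ : Carrier) (a′ : List Carrier) (aⱼ≢0 : aⱼ ≢ 0#)
                        (m′≤n′ : length a′ ≤ n′) (count-tail : PrefixCount (length a′)) where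
    private
      m′ m n L d : ℕ
      m′ = length a′
      m = j + suc m′
      n = j + suc n′
      L = suc n
      d = 2 + j
      1/a : Series
      1/a = reciprocal (toSeries (aⱼ ∷ a′)) aⱼ≢0
      b₀ : Carrier
      b₀ = 1/a 0
      b′ b : List Carrier
      b′ = takeCoeffs m′ (λ i → 1/a (suc i))
      b = b₀ ∷ b′
      b₀≢0 : b₀ ≢ 0#
      b₀≢0 = reciprocal-head≢0 (toSeries (aⱼ ∷ a′)) aⱼ≢0
      φ ψ : List Carrier → List Carrier
      φ = reciprocalTail aⱼ a′ aⱼ≢0 L
      ψ = reciprocalTail b₀ b′ b₀≢0 L

      length-b : length b ≡ suc m′
      length-b = length-takeCoeffs (suc m′) 1/a

      LowRank-φ : ∀ ys → LowRank m n ((replicate j 0# ++ aⱼ ∷ a′) ++ ys) ⇔ LowRank m′ n′ (drop d (b ++ φ ys))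
      LowRank-φ ys = begin
        LowRank m n ((replicate j 0# ++ aⱼ ∷ a′) ++ ys)
          ≡⟨ cong (LowRank m n) (ListP.++-assoc (replicate j 0#) (aⱼ ∷ a′) ys) ⟩
        LowRank m n (replicate j 0# ++ aⱼ ∷ a′ ++ ys)
          ∼⟨ LowRank-reciprocal⇔ j m′ n′ aⱼ a′ aⱼ≢0 ys ⟩
        LowRank m′ n′ (drop d (takeCoeffs (suc m′ + L) (reciprocal (toSeries (aⱼ ∷ a′ ++ ys)) aⱼ≢0)))
          ≡⟨ cong (λ T → LowRank m′ n′ (drop d T)) (reciprocal-++ aⱼ a′ aⱼ≢0 L ys) ⟩
        LowRank m′ n′ (drop d (b ++ φ ys)) ∎
        where open Related.EquationalReasoning {k = Related.equivalence}

      φψ : ∀ zs → length zs ≡ L → φ (ψ zs) ≡ zs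
      φψ zs = reciprocalTail-involutive b₀ b′ b₀≢0 aⱼ a′ aⱼ≢0 L zs (sym (reciprocalPrefix-involutive aⱼ a′ aⱼ≢0 b₀ b′ b₀≢0 refl))

      ψφ : ∀ ys → length ys ≡ L → ψ (φ ys) ≡ ys
      ψφ ys = reciprocalTail-involutive aⱼ a′ aⱼ≢0 b₀ b′ b₀≢0 L ys refl

      Transformed : List Carrier → Set c
      Transformed zs = length zs ≡ L × LowRank m′ n′ (drop d (b ++ zs))

      -- The d dropped coefficients either lie inside b, leaving a prefix of b, or reach d - |b| entries into zs.
      count-transformed : HasCardinality Transformed (q ^ m)
      count-transformed with suc j ≤? m′
      ... | yes j<m′ = subst (HasCardinality Transformed) (cong (q ^_) (sym (ℕₚ.+-suc j m′)))
        (HasCardinality-cong (λ zs → ⇔-refl ×-⇔ Related.≡⇒ (cong (LowRank m′ n′) (sym (drop-++-≤ d b zs d≤b))))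
          (count-tail n′ m′≤n′ (suc j) (length (drop d b)) length-drop (drop d b) refl))
        where
        d≤b : d ≤ length b
        d≤b = subst (d ≤_) (sym length-b) (s≤s j<m′)
        length-drop : length (drop d b) + suc j ≡ m′
        length-drop = trans (cong (_+ suc j) (trans (ListP.length-drop d b) (cong (_∸ d) length-b))) (ℕₚ.m∸n+n≡m j<m′)
      ... | no j≮m′ = subst₂ (λ L N → HasCardinality (λ zs → length zs ≡ L × LowRank m′ n′ (drop d (b ++ zs))) N) length≡ count≡
        (HasCardinality-cong (λ zs → ⇔-refl ×-⇔ Related.≡⇒ (cong (LowRank m′ n′) (sym (drop-from-tail zs))))
          (count-after-drop d₂ (LowRank m′ n′) (count-tail n′ m′≤n′ m′ 0 refl [] refl)))
        where
        m′≤1+j : m′ ≤ suc j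
        m′≤1+j = ℕₚ.<⇒≤ (ℕₚ.≰⇒> j≮m′)
        d₂ = suc j ∸ m′
        d₂+m′≡1+j : d₂ + m′ ≡ suc j
        d₂+m′≡1+j = ℕₚ.m∸n+n≡m m′≤1+j
        drop-from-tail : ∀ zs → drop d (b ++ zs) ≡ drop d₂ zs
        drop-from-tail zs = trans (drop-++-≥ d b zs (subst (_≤ d) (sym length-b) (s≤s m′≤1+j))) (cong (λ k → drop (d ∸ k) zs) length-b)
        length≡ : d₂ + (m′ + suc n′) ≡ L
        length≡ = trans (sym (ℕₚ.+-assoc d₂ m′ (suc n′))) (cong (_+ suc n′) d₂+m′≡1+j)
        count≡ : q ^ d₂ * q ^ (m′ + m′) ≡ q ^ m
        count≡ = trans (sym (ℕₚ.^-distribˡ-+-* q d₂ (m′ + m′)))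
                   (cong (q ^_) (trans (sym (ℕₚ.+-assoc d₂ m′ m′)) (trans (cong (_+ m′) d₂+m′≡1+j) (sym (ℕₚ.+-suc j m′)))))

    count : ExtensionCount m n (replicate j 0# ++ aⱼ ∷ a′)
    count = HasCardinality-bijection ψ φ
      (λ zs (length≡ , lowRank) → length-reciprocalTail b₀ b′ b₀≢0 L zs ,
         Equivalence.from (LowRank-φ (ψ zs)) (subst (λ xs → LowRank m′ n′ (drop d (b ++ xs))) (sym (φψ zs length≡)) lowRank))
      (λ ys (_ , lowRank) → length-reciprocalTail aⱼ a′ aⱼ≢0 L ys , Equivalence.to (LowRank-φ ys) lowRank)
      (λ zs (length≡ , _) → φψ zs length≡)
      (λ ys (length≡ , _) → ψφ ys length≡)
      count-transformed

  count-full-prefix : ∀ m → FullPrefixCount m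
  count-full-prefix = <-rec FullPrefixCount step
    where
    step : ∀ m → (∀ {m′} → m′ < m → FullPrefixCount m′) → FullPrefixCount m
    step m count-smaller n m≤n a length≡m with leading-zeros a
    ... | inj₁ a≡0 = ExtensionCount-≡ refl refl (sym (trans a≡0 (cong (λ k → replicate k 0#) length≡m))) (count-zero-prefix m n m≤n)
    ... | inj₂ (j , aⱼ , a′ , aⱼ≢0 , a≡) = ExtensionCount-≡ m≡ n≡ (sym a≡)
          (FullPrefixStep.count j n′ aⱼ a′ aⱼ≢0 m′≤n′ (count-short-prefix m′ (count-smaller m′<m)))
      where
      m′ = length a′
      m≡ : j + suc m′ ≡ m
      m≡ = trans (sym (trans (cong length a≡) (trans (ListP.length-++ (replicate j 0#)) (cong (_+ suc m′) (ListP.length-replicate j))))) length≡m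
      m′<m : m′ < m
      m′<m = subst (m′ <_) m≡ (ℕₚ.≤-trans (s≤s (ℕₚ.m≤n+m m′ j)) (ℕₚ.≤-reflexive (sym (ℕₚ.+-suc j m′))))
      n′ = n ∸ suc j
      n≡ : j + suc n′ ≡ n
      n≡ = trans (ℕₚ.+-suc j n′) (ℕₚ.m+[n∸m]≡n (ℕₚ.≤-trans (subst (j <_) m≡ (ℕₚ.m<m+n j (s≤s z≤n))) m≤n))
      m′≤n′ : m′ ≤ n′
      m′≤n′ = ℕₚ.≤-pred (ℕₚ.+-cancelˡ-≤ j (suc m′) (suc n′) (subst₂ _≤_ (sym m≡) (sym n≡) m≤n))

  count-prefix : ∀ m → PrefixCount m
  count-prefix m = count-short-prefix m (count-full-prefix m)

module FiniteFieldCount {c : Level} {q : ℕ} (𝔽 : FiniteField c q) where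
  open FiniteField 𝔽 using (field′; Carrier; enumeration)
  open Inverse enumeration using (to; from; strictlyInverseˡ; strictlyInverseʳ)
  open Nat using (_+_; _*_; _^_; _∸_; _<_; _≤_)

  _≟_ : DecidableEquality Carrier
  x ≟ y = Dec.map′ (λ tx≡ty → trans (sym (strictlyInverseʳ x)) (trans (cong from tx≡ty) (strictlyInverseʳ y)))
                   (cong to) (to x Fin.≟ to y)

  alphabet : List Carrier
  alphabet = map from (List.allFin q)

  alphabet-unique : Unique alphabet
  alphabet-unique = UniqueP.map⁺ (λ {a} {b} from≡ → trans (sym (strictlyInverseˡ a)) (trans (cong to from≡) (strictlyInverseˡ b)))
                                 (UniqueP.allFin⁺ q)

  alphabet-complete : ∀ e → e ∈ alphabet
  alphabet-complete e = subst (_∈ alphabet) (strictlyInverseʳ e) (MemP.∈-map⁺ from (MemP.∈-allFin (to e)))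

  length-alphabet : length alphabet ≡ q
  length-alphabet = trans (ListP.length-map from (List.allFin q)) (ListP.length-tabulate (λ i → i))

  open Field field′ using (0#)
  open PadeConditions field′ _≟_ using (hankel; dependentRows⇒PadeCondition; PadeCondition⇒dependentRows)
  open LinearAlgebra field′ _≟_
  open PowerSeries field′ using (AgreeBelow)
  open ListSeries field′ _≟_
  open LowRankRecursion field′ _≟_ using (LowRank)
  open Cardinality
  open ListsOver alphabet alphabet-unique alphabet-complete using (count-all)
  open HankelCounting field′ _≟_ alphabet alphabet-unique alphabet-complete using (count-prefix)
  open ≡-Reasoning

  lookup≡toSeries : ∀ {N} (x : Vec Carrier N) i → lookup x i ≡ toSeries (toList x) (toℕ i)
  lookup≡toSeries (x Vec.∷ xs) Fin.zero    = refl
  lookup≡toSeries (x Vec.∷ xs) (Fin.suc i) = lookup≡toSeries xs i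

  toList-tabulate : ∀ N (s : ℕ → Carrier) → toList (tabulate {n = N} (λ i → s (toℕ i))) ≡ takeCoeffs N s
  toList-tabulate zero    s = refl
  toList-tabulate (suc N) s = cong (s 0 ∷_) (toList-tabulate N (λ i → s (suc i)))

  toSeries-take : ∀ k xs i → i < k → toSeries (take k xs) i ≡ toSeries xs i
  toSeries-take (suc k) []       i       _         = refl
  toSeries-take (suc k) (x ∷ xs) zero    _         = refl
  toSeries-take (suc k) (x ∷ xs) (suc i) (s≤s i<k) = toSeries-take k xs i i<k

  Hankel≗hankel : ∀ m n (x : Vec Carrier (suc (m + n))) i j → Hankel field′ m n x i j ≡ hankel m n (toSeries (toList x)) i j
  Hankel≗hankel m n x i j = trans (lookup≡toSeries x _) (cong (toSeries (toList x)) (Finₚ.toℕ-fromℕ< _))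

  RankAtMost⇔LowRank : ∀ m n (x : Vec Carrier (suc (m + n))) → RankAtMost field′ m (Hankel field′ m n x) ⇔ LowRank m n (toList x)
  RankAtMost⇔LowRank m n x = mk⇔
    (dependentRows⇒PadeCondition m n xₛ ∘ LinearlyDependent-resp (Hankel≗hankel m n x) ∘ rankAtMost⇒dependentRows H)
    (dependentRows⇒rankAtMost H ∘ LinearlyDependent-resp (λ i j → sym (Hankel≗hankel m n x i j)) ∘ PadeCondition⇒dependentRows m n xₛ)
    where
    H = Hankel field′ m n x
    xₛ = toSeries (toList x)

  prefix-take : ∀ {k N} (k≤N : k ≤ N) (x : Vec Carrier N) (a : Vec Carrier k) → PrefixIs field′ k≤N x a → take k (toList x) ≡ toList a
  prefix-take {k} {N} k≤N x a prefix = toSeries-injective _ (toList a) length≡ agree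
    where
    length≡ : length (take k (toList x)) ≡ length (toList a)
    length≡ = trans (ListP.length-take k (toList x))
                (trans (trans (cong (k Nat.⊓_) (VecP.length-toList x)) (ℕₚ.m≤n⇒m⊓n≡m k≤N)) (sym (VecP.length-toList a)))
    agree : AgreeBelow (length (take k (toList x))) (toSeries (take k (toList x))) (toSeries (toList a))
    agree i i<len = begin
      toSeries (take k (toList x)) i                  ≡⟨ toSeries-take k (toList x) i i<k ⟩
      toSeries (toList x) i                           ≡⟨ cong (toSeries (toList x)) (sym (trans (Finₚ.toℕ-inject≤ i′ k≤N) (Finₚ.toℕ-fromℕ< i<k))) ⟩
      toSeries (toList x) (toℕ (Fin.inject≤ i′ k≤N))  ≡⟨ sym (lookup≡toSeries x _) ⟩
      lookup x (Fin.inject≤ i′ k≤N)                   ≡⟨ prefix i′ ⟩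
      lookup a i′                                     ≡⟨ lookup≡toSeries a i′ ⟩
      toSeries (toList a) (toℕ i′)                    ≡⟨ cong (toSeries (toList a)) (Finₚ.toℕ-fromℕ< i<k) ⟩
      toSeries (toList a) i                           ∎
      where
      i<k : i < k
      i<k = subst (i <_) (trans length≡ (VecP.length-toList a)) i<len
      i′ = fromℕ< i<k

  vectorOf : ∀ N → List Carrier → Vec Carrier N
  vectorOf N xs = tabulate (λ i → toSeries xs (toℕ i))

  toList-vectorOf : ∀ N xs → length xs ≡ N → toList (vectorOf N xs) ≡ xs
  toList-vectorOf N xs refl = trans (toList-tabulate N (toSeries xs)) (takeCoeffs-toSeries xs)

  vectorOf-toList : ∀ {N} (x : Vec Carrier N) → vectorOf N (toList x) ≡ x
  vectorOf-toList x = trans (VecP.tabulate-cong (λ i → sym (lookup≡toSeries x i))) (VecP.tabulate∘lookup x)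

  vectorOf-prefix : ∀ {k N} (k≤N : k ≤ N) (a : Vec Carrier k) ys → PrefixIs field′ k≤N (vectorOf N (toList a ++ ys)) a
  vectorOf-prefix k≤N a ys i = begin
    lookup (vectorOf _ (toList a ++ ys)) (Fin.inject≤ i k≤N)  ≡⟨ VecP.lookup∘tabulate _ (Fin.inject≤ i k≤N) ⟩
    toSeries (toList a ++ ys) (toℕ (Fin.inject≤ i k≤N))       ≡⟨ cong (toSeries (toList a ++ ys)) (Finₚ.toℕ-inject≤ i k≤N) ⟩
    toSeries (toList a ++ ys) (toℕ i)                         ≡⟨ toSeries-++ˡ (toList a) ys (toℕ i) i<length-a ⟩
    toSeries (toList a) (toℕ i)                               ≡⟨ sym (lookup≡toSeries a i) ⟩
    lookup a i                                                ∎
    where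
    i<length-a = subst (toℕ i <_) (sym (VecP.length-toList a)) (Finₚ.toℕ<n i)

  prefix++drop : ∀ {k N} (k≤N : k ≤ N) (x : Vec Carrier N) (a : Vec Carrier k) → PrefixIs field′ k≤N x a →
                 toList a ++ drop k (toList x) ≡ toList x
  prefix++drop {k} k≤N x a prefix =
    trans (cong (_++ drop k (toList x)) (sym (prefix-take k≤N x a prefix))) (ListP.take++drop≡id k (toList x))

  count-vectors-with-prefix : ∀ {ℓ k N L M} (k≤N : k ≤ N) (a : Vec Carrier k)
    (P : Vec Carrier N → Set c) (R : List Carrier → Set ℓ) → k + L ≡ N → (∀ x → P x ⇔ R (toList x)) →
    HasCardinality (λ ys → length ys ≡ L × R (toList a ++ ys)) M →
    HasCardinality (λ x → PrefixIs field′ k≤N x a × P x) M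
  count-vectors-with-prefix {k = k} {N} {L} k≤N a P R k+L≡N P⇔R = HasCardinality-bijection
    (λ ys → vectorOf N (toList a ++ ys)) (λ x → drop k (toList x))
    (λ ys (length≡L , Rys) → vectorOf-prefix k≤N a ys ,
       Equivalence.from (P⇔R _) (subst R (sym (toList-vectorOf N (toList a ++ ys) (length-a++ ys length≡L))) Rys))
    (λ x (prefix , Px) → length-drop x , subst R (sym (prefix++drop k≤N x a prefix)) (Equivalence.to (P⇔R x) Px))
    (λ ys (length≡L , _) → trans (cong (drop k) (toList-vectorOf N (toList a ++ ys) (length-a++ ys length≡L))) (drop-prefix ys))
    (λ x (prefix , _) → trans (cong (vectorOf N) (prefix++drop k≤N x a prefix)) (vectorOf-toList x))
    where
    length-a : length (toList a) ≡ k
    length-a = VecP.length-toList a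
    length-a++ : ∀ ys → length ys ≡ L → length (toList a ++ ys) ≡ N
    length-a++ ys length≡L = trans (ListP.length-++ (toList a)) (trans (cong₂ _+_ length-a length≡L) k+L≡N)
    length-drop : ∀ x → length (drop k (toList x)) ≡ L
    length-drop x = trans (ListP.length-drop k (toList x))
                      (trans (cong (_∸ k) (trans (VecP.length-toList x) (sym k+L≡N))) (ℕₚ.m+n∸m≡n k L))
    drop-prefix : ∀ ys → drop k (toList a ++ ys) ≡ ys
    drop-prefix ys = trans (drop-++-≥ k (toList a) ys (ℕₚ.≤-reflexive length-a))
                           (cong (λ l → drop l ys) (trans (cong (k ∸_) length-a) (ℕₚ.n∸n≡0 k)))

  m∸k+m≡2m∸k : ∀ {k m} → k ≤ m → (m ∸ k) + m ≡ 2 * m ∸ k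
  m∸k+m≡2m∸k {k} {m} k≤m = trans (sym (ℕₚ.+-∸-comm m k≤m)) (cong (λ l → m + l ∸ k) (sym (ℕₚ.+-identityʳ m)))

  count-when-m≤n : ∀ {k m n} (k≤N : k ≤ suc (m + n)) → k ≤ m → m ≤ n → (a : Vec Carrier k) →
    HasCardinality (λ x → PrefixIs field′ k≤N x a × RankAtMost field′ m (Hankel field′ m n x)) (q ^ (2 * m ∸ k))
  count-when-m≤n {k} {m} {n} k≤N k≤m m≤n a =
    count-vectors-with-prefix k≤N a _ (LowRank m n) k+L≡N (RankAtMost⇔LowRank m n)
      (subst (HasCardinality _) (cong₂ _^_ length-alphabet (m∸k+m≡2m∸k k≤m))
        (count-prefix m n m≤n (m ∸ k) k (ℕₚ.m+[n∸m]≡n k≤m) (toList a) (VecP.length-toList a)))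
    where
    k+L≡N : k + ((m ∸ k) + suc n) ≡ suc (m + n)
    k+L≡N = trans (sym (ℕₚ.+-assoc k (m ∸ k) (suc n))) (trans (cong (_+ suc n) (ℕₚ.m+[n∸m]≡n k≤m)) (ℕₚ.+-suc m n))

  -- For m = n + 1 the rank condition holds for every x: H_{m,n}(x) has only m columns.
  count-when-m≡1+n : ∀ {k m n} (k≤N : k ≤ suc (m + n)) → k ≤ m → m ≡ suc n → (a : Vec Carrier k) →
    HasCardinality (λ x → PrefixIs field′ k≤N x a × RankAtMost field′ m (Hankel field′ m n x)) (q ^ (2 * m ∸ k))
  count-when-m≡1+n {k} {m} {n} k≤N k≤m m≡1+n a =
    count-vectors-with-prefix k≤N a _ (λ _ → ⊤) k+L≡N
      (λ x → mk⇔ (λ _ → tt) (λ _ → rankAtMost-columns (Hankel field′ m n x) (ℕₚ.≤-reflexive (sym m≡1+n))))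
      (subst (HasCardinality _) (cong₂ _^_ length-alphabet (m∸k+m≡2m∸k k≤m)) (count-all ((m ∸ k) + m)))
    where
    k+L≡N : k + ((m ∸ k) + m) ≡ suc (m + n)
    k+L≡N = trans (sym (ℕₚ.+-assoc k (m ∸ k) m)) (trans (cong (_+ m) (ℕₚ.m+[n∸m]≡n k≤m)) (trans (cong (m +_) m≡1+n) (ℕₚ.+-suc m n)))

open Nat using (_+_; _*_; _∸_; _^_; _≤_)
open ℕₚ using (≤-trans; m≤m+n; n≤1+n)

lemma3p7 : ∀ {c : Level} {q : ℕ} (F : FiniteField c q) (k m n : ℕ) →
    (k≤m : k ≤ m) → m ≤ n + 1 →
    (a : Vec (FiniteField.Carrier F) k) →
    HasCardinality
      (λ (x : Vec (FiniteField.Carrier F) (suc (m + n))) →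
        PrefixIs (FiniteField.field′ F) (≤-trans k≤m (≤-trans (m≤m+n m n) (n≤1+n (m + n)))) x a
        × RankAtMost (FiniteField.field′ F) m (Hankel (FiniteField.field′ F) m n x))
      (q ^ (2 * m ∸ k))
lemma3p7 F k m n k≤m m≤n+1 a =
  [ (λ m≤n → count-when-m≤n F k≤N k≤m m≤n a)
  , (λ n<m → count-when-m≡1+n F k≤N k≤m (ℕₚ.≤-antisym (subst (m ≤_) (ℕₚ.+-comm n 1) m≤n+1) n<m) a)
  ]′ (ℕₚ.≤-<-connex m n)
  where
  open FiniteFieldCount
  k≤N : k ≤ suc (m + n)
  k≤N = ≤-trans k≤m (≤-trans (m≤m+n m n) (n≤1+n (m + n)))
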